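{- Let $\ell(k) := \lim_{n\to\infty} P(2n-1-|S-S| = k)$, where $S$ is a uniformly random subset of $[n]=\{0,\dots,n-1\}$ (the limit exists for every $k\ge0$). Then $\sum_{i=0}^{\infty} i\,\ell(i) = 6$.
   Context: For a positive integer $n$, $[n] := \{0,1,\dots,n-1\}$, random subsets are uniform over all $2^n$ subsets, and $S-S := \{x-y : x,y\in S\}$. -}

module Defs where

open import Data.Bool using (Bool; true; false; _∧_; _∨_; if_then_else_)
open import Data.Nat as ℕ using (ℕ; zero; suc; _∸_)
open import Data.Integer as ℤ using (ℤ; +_)
open import Data.Fin using (Fin; toℕ)
open import Data.Vec using (Vec; []; _∷_; lookup)
open import Data.List using (List; []; _∷_; map; filterᵇ; length; upTo; concatMap; sum; foldr)
open import Data.List as L using ()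
open import Data.Bool.ListAction using (any)
open import Data.Fin.Base using ()
open import Data.Rational as ℚ using (ℚ; ½; 1ℚ; _*_; _+_)
open import Relation.Nullary.Decidable using (⌊_⌋)
open import Data.List using (allFin)

SubsetOf : ℕ → Set
SubsetOf n = Vec Bool n

allSubsets : (n : ℕ) → List (SubsetOf n)
allSubsets zero    = [] ∷ []
allSubsets (suc n) = map (false ∷_) (allSubsets n) L.++ map (true ∷_) (allSubsets n)

inDiff : ∀ {n} → SubsetOf n → ℤ → Bool
inDiff {n} S d =
  any (λ x → any (λ y → lookup S x ∧ lookup S y ∧ ⌊ (+ toℕ x ℤ.- + toℕ y) ℤ.≟ d ⌋) (allFin n)) (allFin n)

-- All integers d with -(n-1) ≤ d ≤ n-1; S - S is always contained in this range.
diffRange : ℕ → List ℤ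
diffRange n = map (λ i → + i ℤ.- + (n ∸ 1)) (upTo ((2 ℕ.* n) ∸ 1))

diffCard : ∀ {n} → SubsetOf n → ℕ
diffCard {n} S = length (filterᵇ (inDiff S) (diffRange n))

-- 2n - 1 - |S - S|   (never truncated, since |S - S| ≤ 2n - 1)
missing : ∀ {n} → SubsetOf n → ℕ
missing {n} S = ((2 ℕ.* n) ∸ 1) ∸ diffCard S

countMissing : ℕ → ℕ → ℕ
countMissing n k = length (filterᵇ (λ S → ⌊ missing S ℕ.≟ k ⌋) (allSubsets n))

half^ : ℕ → ℚ
half^ zero    = 1ℚ
half^ (suc n) = ½ * half^ n

prob : ℕ → ℕ → ℚ
prob n k = ((+ countMissing n k) ℚ./ 1) * half^ n

partialMean : ℕ → ℕ → ℚ
partialMean n K = foldr _+_ ℚ.0ℚ (map (λ i → ((+ i) ℚ./ 1) * prob n i) (upTo K))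

-- For S ⊆ [n] and 1 ≤ d < n, the difference d is absent from S - S exactly when S
-- contains no pair {x, x + d}.  For d ≥ n/2 these n - d pairs are disjoint, so
-- P(d ∉ S - S) = (3/4)^(n-d); for smaller d one still finds about n/4 disjoint such
-- pairs, so P(d ∉ S - S) ≤ (3/4)^(n/4).  Hence, with probability tending to 1, every
-- difference up to n - 1 - t occurs, and then, as d and -d are missing together,
-- 2n - 1 - |S - S| is twice the number of j < t with n - 1 - j ∉ S - S.  That number
-- depends only on the first and the last t points of S, so its law does not depend
-- on n, which gives the limits ℓ(k), and Σ i ℓ(i) = 2 Σ_{j≥0} (3/4)^(j+1) = 6.  The
-- tail beyond K is negligible: a count above K > 2J forces some n - 1 - j with j ≥ J
-- to be missing, which happens with probability at most 3 (3/4)^J.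

module Submission where

open import Defs

module IntegerArithmetic where

  open import Data.Nat using (_+_)
  open import Data.Integer as ℤ using (ℤ)
  import Data.Integer.Properties as ℤ
  open import Data.Integer.Solver using (module +-*-Solver)
  open import Relation.Binary.PropositionalEquality

  open +-*-Solver

  ℤ-diff≡⇒+≡ : ∀ x y a b → ℤ.+ x ℤ.- ℤ.+ y ≡ ℤ.+ a ℤ.- ℤ.+ b → x + b ≡ y + a
  ℤ-diff≡⇒+≡ x y a b eq = ℤ.+-injective (begin
    ℤ.+ x ℤ.+ ℤ.+ b                                  ≡⟨ shift (ℤ.+ x) (ℤ.+ y) (ℤ.+ b) ⟩
    (ℤ.+ x ℤ.- ℤ.+ y) ℤ.+ (ℤ.+ y ℤ.+ ℤ.+ b)          ≡⟨ cong (ℤ._+ (ℤ.+ y ℤ.+ ℤ.+ b)) eq ⟩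
    (ℤ.+ a ℤ.- ℤ.+ b) ℤ.+ (ℤ.+ y ℤ.+ ℤ.+ b)          ≡⟨ unshift (ℤ.+ a) (ℤ.+ b) (ℤ.+ y) ⟩
    ℤ.+ y ℤ.+ ℤ.+ a                                  ∎)
    where
    open ≡-Reasoning
    shift : ∀ X Y B → X ℤ.+ B ≡ (X ℤ.- Y) ℤ.+ (Y ℤ.+ B)
    shift = solve 3 (λ X Y B → X :+ B := (X :- Y) :+ (Y :+ B)) refl
    unshift : ∀ A B Y → (A ℤ.- B) ℤ.+ (Y ℤ.+ B) ≡ Y ℤ.+ A
    unshift = solve 3 (λ A B Y → (A :- B) :+ (Y :+ B) := Y :+ A) refl

  +≡⇒ℤ-diff≡ : ∀ x y a b → x + b ≡ y + a → ℤ.+ x ℤ.- ℤ.+ y ≡ ℤ.+ a ℤ.- ℤ.+ b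
  +≡⇒ℤ-diff≡ x y a b eq = begin
    ℤ.+ x ℤ.- ℤ.+ y
      ≡⟨ regroup (ℤ.+ x) (ℤ.+ y) (ℤ.+ a) (ℤ.+ b) ⟩
    (ℤ.+ (x + b) ℤ.- ℤ.+ (y + a)) ℤ.+ (ℤ.+ a ℤ.- ℤ.+ b)
      ≡⟨ cong (λ k → (ℤ.+ k ℤ.- ℤ.+ (y + a)) ℤ.+ (ℤ.+ a ℤ.- ℤ.+ b)) eq ⟩
    (ℤ.+ (y + a) ℤ.- ℤ.+ (y + a)) ℤ.+ (ℤ.+ a ℤ.- ℤ.+ b)
      ≡⟨ cong (ℤ._+ (ℤ.+ a ℤ.- ℤ.+ b)) (ℤ.+-inverseʳ (ℤ.+ (y + a))) ⟩
    ℤ.0ℤ ℤ.+ (ℤ.+ a ℤ.- ℤ.+ b)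
      ≡⟨ ℤ.+-identityˡ _ ⟩
    ℤ.+ a ℤ.- ℤ.+ b
      ∎
    where
    open ≡-Reasoning
    regroup : ∀ X Y A B → X ℤ.- Y ≡ ((X ℤ.+ B) ℤ.- (Y ℤ.+ A)) ℤ.+ (A ℤ.- B)
    regroup = solve 4 (λ X Y A B → X :- Y := ((X :+ B) :- (Y :+ A)) :+ (A :- B)) refl

module Counting where

  open import Data.Bool using (Bool; true; false; not; T; _∧_; _∨_)
  open import Data.Bool.Properties using (T-∧; T-∨; T-≡; not-injective)
  open import Data.Empty using (⊥-elim)
  open import Data.Fin using (Fin; toℕ; fromℕ<)
  open import Data.Fin.Properties using (toℕ-fromℕ<)
  open import Data.Integer as ℤ using (ℤ)
  open import Data.List using (List; []; _∷_; map; length; filterᵇ; applyUpTo; allFin)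
  open import Data.List.Membership.Propositional using (lose)
  open import Data.List.Membership.Propositional.Properties using (∈-allFin)
  open import Data.List.Properties using (map-++; map-∘; length-++; length-map; length-applyUpTo)
  open import Data.List.Relation.Unary.Any using (satisfied)
  open import Data.List.Relation.Unary.Any.Properties using (any⁺; any⁻)
  open import Data.Nat
  open import Data.Nat.DivMod using (_/_; _%_; m≡m%n+[m/n]*n; m%n<n)
  open import Data.Nat.ListAction using (sum)
  open import Data.Nat.ListAction.Properties using (sum-++)
  open import Data.Nat.Properties
  open import Data.Nat.Solver using (module +-*-Solver)
  open import Data.Product using (∃-syntax; _×_; _,_; proj₁; proj₂)
  open import Data.Sum using (inj₁; inj₂)
  open import Data.Vec using ([]; _∷_; _++_; lookup)
  open import Function using (_∘_; Equivalence)
  open import Relation.Binary.PropositionalEquality hiding (J)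
  open import Relation.Nullary using (yes; no; ¬_)
  open import Relation.Nullary.Decidable using (⌊_⌋; toWitness; fromWitness; dec-false; isYes≗does)

  open import Algebra.Properties.CommutativeSemigroup +-commutativeSemigroup using (interchange)
  open IntegerArithmetic
  open +-*-Solver

  -- Finite sums

  𝟙 : Bool → ℕ
  𝟙 true  = 1
  𝟙 false = 0

  𝟙≤1 : ∀ b → 𝟙 b ≤ 1
  𝟙≤1 true  = ≤-refl
  𝟙≤1 false = z≤n

  T⇔T⇒≡ : {x y : Bool} → (T x → T y) → (T y → T x) → x ≡ y
  T⇔T⇒≡ {true}  {true}  _ _ = refl
  T⇔T⇒≡ {true}  {false} f _ = ⊥-elim (f _)
  T⇔T⇒≡ {false} {true}  _ g = ⊥-elim (g _)
  T⇔T⇒≡ {false} {false} _ _ = refl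

  ∑ₗ : {A : Set} → List A → (A → ℕ) → ℕ
  ∑ₗ xs f = sum (map f xs)

  module _ {A : Set} where

    ∑ₗ-cong : ∀ xs {f g : A → ℕ} → (∀ x → f x ≡ g x) → ∑ₗ xs f ≡ ∑ₗ xs g
    ∑ₗ-cong []       f≗g = refl
    ∑ₗ-cong (x ∷ xs) f≗g = cong₂ _+_ (f≗g x) (∑ₗ-cong xs f≗g)

    ∑ₗ-mono : ∀ xs {f g : A → ℕ} → (∀ x → f x ≤ g x) → ∑ₗ xs f ≤ ∑ₗ xs g
    ∑ₗ-mono []       f≤g = z≤n
    ∑ₗ-mono (x ∷ xs) f≤g = +-mono-≤ (f≤g x) (∑ₗ-mono xs f≤g)

    ∑ₗ-+ : ∀ xs (f g : A → ℕ) → ∑ₗ xs (λ x → f x + g x) ≡ ∑ₗ xs f + ∑ₗ xs g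
    ∑ₗ-+ []       f g = refl
    ∑ₗ-+ (x ∷ xs) f g = trans (cong ((f x + g x) +_) (∑ₗ-+ xs f g)) (interchange (f x) (g x) (∑ₗ xs f) (∑ₗ xs g))

    ∑ₗ-*ˡ : ∀ xs c (f : A → ℕ) → ∑ₗ xs (λ x → c * f x) ≡ c * ∑ₗ xs f
    ∑ₗ-*ˡ []       c f = sym (*-zeroʳ c)
    ∑ₗ-*ˡ (x ∷ xs) c f = trans (cong (c * f x +_) (∑ₗ-*ˡ xs c f)) (sym (*-distribˡ-+ c (f x) _))

    ∑ₗ-const : ∀ xs c → ∑ₗ xs (λ (_ : A) → c) ≡ c * length xs
    ∑ₗ-const []       c = sym (*-zeroʳ c)
    ∑ₗ-const (x ∷ xs) c = trans (cong (c +_) (∑ₗ-const xs c)) (sym (*-suc c (length xs)))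

    ∑ₗ-++ : ∀ xs ys (f : A → ℕ) → ∑ₗ (xs Data.List.++ ys) f ≡ ∑ₗ xs f + ∑ₗ ys f
    ∑ₗ-++ xs ys f = trans (cong sum (map-++ f xs ys)) (sum-++ (map f xs) (map f ys))

    length-filterᵇ : ∀ (p : A → Bool) xs → length (filterᵇ p xs) ≡ ∑ₗ xs (𝟙 ∘ p)
    length-filterᵇ p []       = refl
    length-filterᵇ p (x ∷ xs) with p x
    ... | true  = cong suc (length-filterᵇ p xs)
    ... | false = length-filterᵇ p xs

    length∸length-filterᵇ : ∀ (p : A → Bool) xs → length xs ∸ length (filterᵇ p xs) ≡ ∑ₗ xs (𝟙 ∘ not ∘ p)
    length∸length-filterᵇ p []       = refl
    length∸length-filterᵇ p (x ∷ xs) with p x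
    ... | true  = length∸length-filterᵇ p xs
    ... | false = trans (+-∸-assoc 1 (length-filterᵇ≤ xs)) (cong suc (length∸length-filterᵇ p xs))
      where
      length-filterᵇ≤ : ∀ ys → length (filterᵇ p ys) ≤ length ys
      length-filterᵇ≤ []       = z≤n
      length-filterᵇ≤ (y ∷ ys) with p y
      ... | true  = s≤s (length-filterᵇ≤ ys)
      ... | false = m≤n⇒m≤1+n (length-filterᵇ≤ ys)

  ∑ₗ-map : ∀ {A B : Set} xs (g : A → B) (f : B → ℕ) → ∑ₗ (map g xs) f ≡ ∑ₗ xs (f ∘ g)
  ∑ₗ-map xs g f = cong sum (sym (map-∘ xs))

  ∑ : ℕ → (ℕ → ℕ) → ℕ
  ∑ zero    f = 0
  ∑ (suc m) f = f 0 + ∑ m (f ∘ suc)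

  ∑ₗ-applyUpTo : ∀ (g : ℕ → ℕ) m (f : ℕ → ℕ) → ∑ₗ (applyUpTo g m) f ≡ ∑ m (f ∘ g)
  ∑ₗ-applyUpTo g zero    f = refl
  ∑ₗ-applyUpTo g (suc m) f = cong (f (g 0) +_) (∑ₗ-applyUpTo (g ∘ suc) m f)

  ∑-cong : ∀ m {f g} → (∀ i → i < m → f i ≡ g i) → ∑ m f ≡ ∑ m g
  ∑-cong zero    f≗g = refl
  ∑-cong (suc m) f≗g = cong₂ _+_ (f≗g 0 z<s) (∑-cong m (λ i i<m → f≗g (suc i) (s<s i<m)))

  ∑-mono : ∀ m {f g} → (∀ i → i < m → f i ≤ g i) → ∑ m f ≤ ∑ m g
  ∑-mono zero    f≤g = z≤n
  ∑-mono (suc m) f≤g = +-mono-≤ (f≤g 0 z<s) (∑-mono m (λ i i<m → f≤g (suc i) (s<s i<m)))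

  ∑-+ : ∀ m f g → ∑ m (λ i → f i + g i) ≡ ∑ m f + ∑ m g
  ∑-+ zero    f g = refl
  ∑-+ (suc m) f g = trans (cong ((f 0 + g 0) +_) (∑-+ m (f ∘ suc) (g ∘ suc))) (interchange (f 0) (g 0) _ _)

  ∑-*ˡ : ∀ m c f → ∑ m (λ i → c * f i) ≡ c * ∑ m f
  ∑-*ˡ zero    c f = sym (*-zeroʳ c)
  ∑-*ˡ (suc m) c f = trans (cong (c * f 0 +_) (∑-*ˡ m c (f ∘ suc))) (sym (*-distribˡ-+ c (f 0) _))

  ∑-const : ∀ m c → ∑ m (λ _ → c) ≡ m * c
  ∑-const zero    c = refl
  ∑-const (suc m) c = cong (c +_) (∑-const m c)

  ∑-++ : ∀ a b f → ∑ (a + b) f ≡ ∑ a f + ∑ b (λ i → f (a + i))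
  ∑-++ zero    b f = refl
  ∑-++ (suc a) b f = trans (cong (f 0 +_) (∑-++ a b (f ∘ suc))) (sym (+-assoc (f 0) _ _))

  ∑-reverse : ∀ m f → ∑ m (λ i → f (m ∸ suc i)) ≡ ∑ m f
  ∑-reverse zero    f = refl
  ∑-reverse (suc m) f = begin
    f m + ∑ m (λ i → f (m ∸ suc i)) ≡⟨ cong (f m +_) (∑-reverse m f) ⟩
    f m + ∑ m f                     ≡⟨ +-comm (f m) (∑ m f) ⟩
    ∑ m f + f m                     ≡⟨ cong (∑ m f +_) (sym (trans (+-identityʳ _) (cong f (+-identityʳ m)))) ⟩
    ∑ m f + ∑ 1 (λ i → f (m + i))   ≡⟨ sym (∑-++ m 1 f) ⟩
    ∑ (m + 1) f                     ≡⟨ cong (λ k → ∑ k f) (+-comm m 1) ⟩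
    ∑ (suc m) f                     ∎
    where open ≡-Reasoning

  ∑ₛ : (n : ℕ) → (SubsetOf n → ℕ) → ℕ
  ∑ₛ n f = ∑ₗ (allSubsets n) f

  ∑ₛ-suc : ∀ n f → ∑ₛ (suc n) f ≡ ∑ₛ n (λ S → f (false ∷ S)) + ∑ₛ n (λ S → f (true ∷ S))
  ∑ₛ-suc n f = trans (∑ₗ-++ (map (false ∷_) (allSubsets n)) _ f)
    (cong₂ _+_ (∑ₗ-map (allSubsets n) (false ∷_) f) (∑ₗ-map (allSubsets n) (true ∷_) f))

  length-allSubsets : ∀ n → length (allSubsets n) ≡ 2 ^ n
  length-allSubsets zero    = refl
  length-allSubsets (suc n) = begin
    length (map (false ∷_) (allSubsets n) Data.List.++ map (true ∷_) (allSubsets n))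
      ≡⟨ length-++ (map (false ∷_) (allSubsets n)) ⟩
    length (map (false ∷_) (allSubsets n)) + length (map (true ∷_) (allSubsets n))
      ≡⟨ cong₂ _+_ (length-map (false ∷_) (allSubsets n)) (length-map (true ∷_) (allSubsets n)) ⟩
    length (allSubsets n) + length (allSubsets n)
      ≡⟨ cong (λ k → k + k) (length-allSubsets n) ⟩
    2 ^ n + 2 ^ n
      ≡⟨ cong (2 ^ n +_) (sym (+-identityʳ (2 ^ n))) ⟩
    2 ^ suc n
      ∎
    where open ≡-Reasoning

  ∑ₛ-const : ∀ n c → ∑ₛ n (λ _ → c) ≡ c * 2 ^ n
  ∑ₛ-const n c = trans (∑ₗ-const (allSubsets n) c) (cong (c *_) (length-allSubsets n))

  ∑ₛ-++ : ∀ a b f → ∑ₛ (a + b) f ≡ ∑ₛ a (λ u → ∑ₛ b (λ w → f (u ++ w)))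
  ∑ₛ-++ zero    b f = sym (+-identityʳ _)
  ∑ₛ-++ (suc a) b f = begin
    ∑ₛ (suc (a + b)) f
      ≡⟨ ∑ₛ-suc (a + b) f ⟩
    ∑ₛ (a + b) (λ S → f (false ∷ S)) + ∑ₛ (a + b) (λ S → f (true ∷ S))
      ≡⟨ cong₂ _+_ (∑ₛ-++ a b (λ S → f (false ∷ S))) (∑ₛ-++ a b (λ S → f (true ∷ S))) ⟩
    ∑ₛ a (λ u → ∑ₛ b (λ w → f (false ∷ u ++ w))) + ∑ₛ a (λ u → ∑ₛ b (λ w → f (true ∷ u ++ w)))
      ≡⟨ sym (∑ₛ-suc a _) ⟩
    ∑ₛ (suc a) (λ u → ∑ₛ b (λ w → f (u ++ w)))
      ∎
    where open ≡-Reasoning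

  ∑ₛ-∑ : ∀ n m (f : SubsetOf n → ℕ → ℕ) → ∑ₛ n (λ S → ∑ m (f S)) ≡ ∑ m (λ i → ∑ₛ n (λ S → f S i))
  ∑ₛ-∑ n zero    f = ∑ₛ-const n 0
  ∑ₛ-∑ n (suc m) f = trans (∑ₗ-+ (allSubsets n) (λ S → f S 0) (λ S → ∑ m (f S ∘ suc)))
    (cong (∑ₛ n (λ S → f S 0) +_) (∑ₛ-∑ n m (λ S → f S ∘ suc)))

  member : ∀ {n} → SubsetOf n → ℕ → Bool
  member []      i       = false
  member (b ∷ S) zero    = b
  member (b ∷ S) (suc i) = member S i

  member-++ˡ : ∀ {a b} (u : SubsetOf a) (w : SubsetOf b) {i} → i < a → member (u ++ w) i ≡ member u i
  member-++ˡ (x ∷ u) w {zero}  _         = refl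
  member-++ˡ (x ∷ u) w {suc i} (s≤s i<a) = member-++ˡ u w i<a

  member-++ʳ : ∀ {a b} (u : SubsetOf a) (w : SubsetOf b) i → member (u ++ w) (a + i) ≡ member w i
  member-++ʳ []      w i = refl
  member-++ʳ (x ∷ u) w i = member-++ʳ u w i

  lookup≡member : ∀ {n} (S : SubsetOf n) (x : Fin n) → lookup S x ≡ member S (toℕ x)
  lookup≡member (b ∷ S) Fin.zero    = refl
  lookup≡member (b ∷ S) (Fin.suc x) = lookup≡member S x

  member⇒< : ∀ {n} (S : SubsetOf n) i → T (member S i) → i < n
  member⇒< (b ∷ S) zero    _ = z<s
  member⇒< (b ∷ S) (suc i) t = s<s (member⇒< S i t)

  anyBelow : ℕ → (ℕ → Bool) → Bool
  anyBelow zero    p = false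
  anyBelow (suc m) p = p 0 ∨ anyBelow m (p ∘ suc)

  anyBelow⁻ : ∀ m p → T (anyBelow m p) → ∃[ i ] (i < m × T (p i))
  anyBelow⁻ (suc m) p t with Equivalence.to T-∨ t
  ... | inj₁ p0 = 0 , z<s , p0
  ... | inj₂ ps with anyBelow⁻ m (p ∘ suc) ps
  ...   | i , i<m , pi = suc i , s<s i<m , pi

  anyBelow⁺ : ∀ m p {i} → i < m → T (p i) → T (anyBelow m p)
  anyBelow⁺ (suc m) p {zero}  _         pi = Equivalence.from T-∨ (inj₁ pi)
  anyBelow⁺ (suc m) p {suc i} (s≤s i<m) pi = Equivalence.from T-∨ (inj₂ (anyBelow⁺ m (p ∘ suc) i<m pi))

  anyBelow-cong : ∀ m {p q} → (∀ i → i < m → p i ≡ q i) → anyBelow m p ≡ anyBelow m q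
  anyBelow-cong zero    p≗q = refl
  anyBelow-cong (suc m) p≗q = cong₂ _∨_ (p≗q 0 z<s) (anyBelow-cong m (λ i i<m → p≗q (suc i) (s<s i<m)))

  𝟙-anyBelow≤∑ : ∀ m p → 𝟙 (anyBelow m p) ≤ ∑ m (𝟙 ∘ p)
  𝟙-anyBelow≤∑ zero    p = z≤n
  𝟙-anyBelow≤∑ (suc m) p with p 0
  ... | true  = s≤s z≤n
  ... | false = 𝟙-anyBelow≤∑ m (p ∘ suc)

  hasDiff : ∀ {n} → SubsetOf n → ℕ → Bool
  hasDiff {n} S d = anyBelow (n ∸ d) (λ x → member S x ∧ member S (x + d))

  hasDiff⁻ : ∀ {n} (S : SubsetOf n) d → T (hasDiff S d) → ∃[ x ] (T (member S x) × T (member S (x + d)))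
  hasDiff⁻ {n} S d t with anyBelow⁻ (n ∸ d) _ t
  ... | x , _ , both = x , Equivalence.to T-∧ both

  hasDiff⁺ : ∀ {n} (S : SubsetOf n) d x → T (member S x) → T (member S (x + d)) → T (hasDiff S d)
  hasDiff⁺ {n} S d x x∈S x+d∈S =
    anyBelow⁺ (n ∸ d) _ (m+n≤o⇒m≤o∸n (suc x) (member⇒< S (x + d) x+d∈S)) (Equivalence.from T-∧ (x∈S , x+d∈S))

  inDiff⁻ : ∀ {n} (S : SubsetOf n) a b → T (inDiff S (ℤ.+ a ℤ.- ℤ.+ b)) →
    ∃[ x ] ∃[ y ] (T (member S x) × T (member S y) × x + b ≡ y + a)
  inDiff⁻ {n} S a b t with satisfied (any⁻ _ (allFin n) t)
  ... | x , tx with satisfied (any⁻ _ (allFin n) tx)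
  ...   | y , txy with Equivalence.to T-∧ txy
  ...     | x∈S , rest with Equivalence.to T-∧ rest
  ...       | y∈S , x-y≡a-b =
    toℕ x , toℕ y , subst T (lookup≡member S x) x∈S , subst T (lookup≡member S y) y∈S ,
    ℤ-diff≡⇒+≡ (toℕ x) (toℕ y) a b (toWitness x-y≡a-b)

  inDiff⁺ : ∀ {n} (S : SubsetOf n) a b x y → T (member S x) → T (member S y) → x + b ≡ y + a →
    T (inDiff S (ℤ.+ a ℤ.- ℤ.+ b))
  inDiff⁺ {n} S a b x y x∈S y∈S eq =
    any⁺ _ (lose (∈-allFin i) (any⁺ _ (lose (∈-allFin j)
      (Equivalence.from T-∧ (i∈S , Equivalence.from T-∧ (j∈S , fromWitness i-j≡a-b))))))
    where
    x<n = member⇒< S x x∈S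
    y<n = member⇒< S y y∈S
    i = fromℕ< x<n
    j = fromℕ< y<n
    i∈S : T (lookup S i)
    i∈S = subst T (sym (trans (lookup≡member S i) (cong (member S) (toℕ-fromℕ< x<n)))) x∈S
    j∈S : T (lookup S j)
    j∈S = subst T (sym (trans (lookup≡member S j) (cong (member S) (toℕ-fromℕ< y<n)))) y∈S
    i-j≡a-b : ℤ.+ toℕ i ℤ.- ℤ.+ toℕ j ≡ ℤ.+ a ℤ.- ℤ.+ b
    i-j≡a-b = subst₂ (λ u v → ℤ.+ u ℤ.- ℤ.+ v ≡ ℤ.+ a ℤ.- ℤ.+ b) (sym (toℕ-fromℕ< x<n)) (sym (toℕ-fromℕ< y<n))
                     (+≡⇒ℤ-diff≡ x y a b eq)

  inDiff≡hasDiff-nonneg : ∀ {n} (S : SubsetOf n) a b → b ≤ a → inDiff S (ℤ.+ a ℤ.- ℤ.+ b) ≡ hasDiff S (a ∸ b)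
  inDiff≡hasDiff-nonneg S a b b≤a = T⇔T⇒≡ to from
    where
    d = a ∸ b
    a≡d+b : a ≡ d + b
    a≡d+b = sym (m∸n+n≡m b≤a)
    to : T (inDiff S (ℤ.+ a ℤ.- ℤ.+ b)) → T (hasDiff S d)
    to t with inDiff⁻ S a b t
    ... | x , y , x∈S , y∈S , x+b≡y+a = hasDiff⁺ S d y y∈S (subst (T ∘ member S) x≡y+d x∈S)
      where
      x≡y+d : x ≡ y + d
      x≡y+d = +-cancelʳ-≡ b x (y + d) (trans x+b≡y+a (trans (cong (y +_) a≡d+b) (sym (+-assoc y d b))))
    from : T (hasDiff S d) → T (inDiff S (ℤ.+ a ℤ.- ℤ.+ b))
    from t with hasDiff⁻ S d t
    ... | y , y∈S , y+d∈S = inDiff⁺ S a b (y + d) y y+d∈S y∈S (trans (+-assoc y d b) (cong (y +_) (sym a≡d+b)))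

  inDiff≡hasDiff-neg : ∀ {n} (S : SubsetOf n) a b → a ≤ b → inDiff S (ℤ.+ a ℤ.- ℤ.+ b) ≡ hasDiff S (b ∸ a)
  inDiff≡hasDiff-neg S a b a≤b = T⇔T⇒≡ to from
    where
    d = b ∸ a
    b≡d+a : b ≡ d + a
    b≡d+a = sym (m∸n+n≡m a≤b)
    to : T (inDiff S (ℤ.+ a ℤ.- ℤ.+ b)) → T (hasDiff S d)
    to t with inDiff⁻ S a b t
    ... | x , y , x∈S , y∈S , x+b≡y+a = hasDiff⁺ S d x x∈S (subst (T ∘ member S) y≡x+d y∈S)
      where
      y≡x+d : y ≡ x + d
      y≡x+d = +-cancelʳ-≡ a y (x + d) (trans (sym x+b≡y+a) (trans (cong (x +_) b≡d+a) (sym (+-assoc x d a))))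
    from : T (hasDiff S d) → T (inDiff S (ℤ.+ a ℤ.- ℤ.+ b))
    from t with hasDiff⁻ S d t
    ... | x , x∈S , x+d∈S = inDiff⁺ S a b x (x + d) x∈S x+d∈S (trans (cong (x +_) b≡d+a) (sym (+-assoc x d a)))

  anyBelow-false : ∀ m p {i} → anyBelow m p ≡ false → i < m → p i ≡ false
  anyBelow-false m p {i} none i<m = T⇔T⇒≡ (λ pi → subst T none (anyBelow⁺ m p i<m pi)) λ ()

  hasDiff⇒hasDiff-0 : ∀ {n} (S : SubsetOf n) d → T (hasDiff S d) → T (hasDiff S 0)
  hasDiff⇒hasDiff-0 S d t with hasDiff⁻ S d t
  ... | x , x∈S , _ = hasDiff⁺ S 0 x x∈S (subst (T ∘ member S) (sym (+-identityʳ x)) x∈S)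

  -- Missing differences

  missing-symmetric : ∀ {m} (S : SubsetOf (suc m)) →
    missing S ≡ 𝟙 (not (hasDiff S 0)) + 2 * ∑ m (λ j → 𝟙 (not (hasDiff S (suc j))))
  missing-symmetric {m} S = begin
    missing S
      ≡⟨ cong (_∸ diffCard S) (sym length-diffRange) ⟩
    length (diffRange n) ∸ length (filterᵇ (inDiff S) (diffRange n))
      ≡⟨ length∸length-filterᵇ (inDiff S) (diffRange n) ⟩
    ∑ₗ (diffRange n) (𝟙 ∘ not ∘ inDiff S)
      ≡⟨ ∑ₗ-map (applyUpTo (λ i → i) (2 * n ∸ 1)) _ _ ⟩
    ∑ₗ (applyUpTo (λ i → i) (2 * n ∸ 1)) (λ i → gap (ℤ.+ i ℤ.- ℤ.+ m))
      ≡⟨ ∑ₗ-applyUpTo (λ i → i) (m + suc (m + 0)) _ ⟩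
    ∑ (m + suc (m + 0)) (λ i → gap (ℤ.+ i ℤ.- ℤ.+ m))
      ≡⟨ ∑-++ m (suc (m + 0)) _ ⟩
    ∑ m (λ i → gap (ℤ.+ i ℤ.- ℤ.+ m)) + (gap (ℤ.+ (m + 0) ℤ.- ℤ.+ m) + ∑ (m + 0) (λ j → gap (ℤ.+ (m + suc j) ℤ.- ℤ.+ m)))
      ≡⟨ cong₂ (λ a b → a + (gap (ℤ.+ (m + 0) ℤ.- ℤ.+ m) + b)) negative positive ⟩
    ∑ m g + (gap (ℤ.+ (m + 0) ℤ.- ℤ.+ m) + ∑ m g)
      ≡⟨ cong (λ b → ∑ m g + (b + ∑ m g)) zero-diff ⟩
    ∑ m g + (𝟙 (not (hasDiff S 0)) + ∑ m g)
      ≡⟨ solve 2 (λ A z → A :+ (z :+ A) := z :+ con 2 :* A) refl (∑ m g) (𝟙 (not (hasDiff S 0))) ⟩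
    𝟙 (not (hasDiff S 0)) + 2 * ∑ m g
      ∎
    where
    open ≡-Reasoning
    n = suc m
    gap : ℤ → ℕ
    gap d = 𝟙 (not (inDiff S d))
    g : ℕ → ℕ
    g j = 𝟙 (not (hasDiff S (suc j)))
    length-diffRange : length (diffRange n) ≡ 2 * n ∸ 1
    length-diffRange = trans (length-map _ (applyUpTo (λ i → i) (2 * n ∸ 1))) (length-applyUpTo (λ i → i) (2 * n ∸ 1))
    negative : ∑ m (λ i → gap (ℤ.+ i ℤ.- ℤ.+ m)) ≡ ∑ m g
    negative = trans (∑-cong m (λ i i<m → cong (𝟙 ∘ not) (trans (inDiff≡hasDiff-neg S i m (<⇒≤ i<m))
                        (cong (hasDiff S) (+-∸-assoc 1 i<m)))))
                     (∑-reverse m g)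
    positive : ∑ (m + 0) (λ j → gap (ℤ.+ (m + suc j) ℤ.- ℤ.+ m)) ≡ ∑ m g
    positive = trans (cong (λ k → ∑ k (λ j → gap (ℤ.+ (m + suc j) ℤ.- ℤ.+ m))) (+-identityʳ m))
      (∑-cong m (λ j _ → cong (𝟙 ∘ not) (trans (inDiff≡hasDiff-nonneg S (m + suc j) m (m≤m+n m (suc j)))
                                              (cong (hasDiff S) (m+n∸m≡n m (suc j))))))
    zero-diff : gap (ℤ.+ (m + 0) ℤ.- ℤ.+ m) ≡ 𝟙 (not (hasDiff S 0))
    zero-diff = cong (𝟙 ∘ not) (trans (inDiff≡hasDiff-nonneg S (m + 0) m (m≤m+n m 0)) (cong (hasDiff S) (m+n∸m≡n m 0)))

  missingWindow : ∀ {n} → SubsetOf n → ℕ → ℕ → ℕ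
  missingWindow {n} S J m = ∑ m (λ i → 𝟙 (not (hasDiff S (n ∸ suc (J + i)))))

  missingTop : ∀ {n} → ℕ → SubsetOf n → ℕ
  missingTop t S = missingWindow S 0 t

  missesLow : ∀ {n} → ℕ → SubsetOf n → Bool
  missesLow {n} t S = anyBelow (n ∸ 1 ∸ t) (λ j → not (hasDiff S (suc j)))

  missing≡missingTop+missingTop : ∀ {n} t (S : SubsetOf n) → suc t < n → missesLow t S ≡ false →
    missing S ≡ missingTop t S + missingTop t S
  missing≡missingTop+missingTop {suc m} t S (s≤s t<m) noLowGap = begin
    missing S
      ≡⟨ missing-symmetric S ⟩
    𝟙 (not (hasDiff S 0)) + 2 * ∑ m g
      ≡⟨ cong₂ (λ b x → 𝟙 (not b) + 2 * x) has-0 (cong (λ k → ∑ k g) (sym (m∸n+n≡m t≤m))) ⟩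
    2 * ∑ (m ∸ t + t) g
      ≡⟨ cong (2 *_) (∑-++ (m ∸ t) t g) ⟩
    2 * (∑ (m ∸ t) g + ∑ t (λ j → g (m ∸ t + j)))
      ≡⟨ cong₂ (λ x y → 2 * (x + y)) low top ⟩
    2 * (0 + missingTop t S)
      ≡⟨ cong (missingTop t S +_) (+-identityʳ (missingTop t S)) ⟩
    missingTop t S + missingTop t S
      ∎
    where
    open ≡-Reasoning
    g : ℕ → ℕ
    g j = 𝟙 (not (hasDiff S (suc j)))
    t≤m = <⇒≤ t<m
    present : ∀ {j} → j < m ∸ t → hasDiff S (suc j) ≡ true
    present j<m∸t = not-injective (anyBelow-false (m ∸ t) _ noLowGap j<m∸t)
    has-0 : hasDiff S 0 ≡ true
    has-0 = Equivalence.to T-≡ (hasDiff⇒hasDiff-0 S 1 (Equivalence.from T-≡ (present (m<n⇒0<n∸m t<m))))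
    low : ∑ (m ∸ t) g ≡ 0
    low = trans (∑-cong (m ∸ t) (λ j j<m∸t → cong (𝟙 ∘ not) (present j<m∸t)))
                (trans (∑-const (m ∸ t) 0) (*-zeroʳ (m ∸ t)))
    reindex : ∀ j → j < t → suc (m ∸ t + (t ∸ suc j)) ≡ m ∸ j
    reindex j j<t = begin
      suc (m ∸ t + (t ∸ suc j))   ≡⟨ cong suc (sym (+-∸-assoc (m ∸ t) j<t)) ⟩
      suc (m ∸ t + t ∸ suc j)     ≡⟨ cong (λ k → suc (k ∸ suc j)) (m∸n+n≡m t≤m) ⟩
      suc (m ∸ suc j)             ≡⟨ sym (+-∸-assoc 1 (<-≤-trans j<t t≤m)) ⟩
      m ∸ j                       ∎
    top : ∑ t (λ j → g (m ∸ t + j)) ≡ missingTop t S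
    top = trans (sym (∑-reverse t (λ j → g (m ∸ t + j))))
                (∑-cong t (λ j j<t → cong (𝟙 ∘ not ∘ hasDiff S) (reindex j j<t)))

  -- Subsets avoiding a difference

  absent : ℕ → ℕ → ℕ
  absent n d = ∑ₛ n (λ S → 𝟙 (not (hasDiff S d)))

  overlaps : ∀ {a} → SubsetOf a → SubsetOf a → Bool
  overlaps {a} u w = anyBelow a (λ x → member u x ∧ member w x)

  ∑ₛ-insert : ∀ a r (g : SubsetOf (a + (r + a)) → ℕ) (h : SubsetOf (a + a) → ℕ) →
    (∀ u v w → g (u ++ (v ++ w)) ≡ h (u ++ w)) → ∑ₛ (a + (r + a)) g ≡ 2 ^ r * ∑ₛ (a + a) h
  ∑ₛ-insert a r g h g≗h = begin
    ∑ₛ (a + (r + a)) g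
      ≡⟨ ∑ₛ-++ a (r + a) g ⟩
    ∑ₛ a (λ u → ∑ₛ (r + a) (λ vw → g (u ++ vw)))
      ≡⟨ ∑ₗ-cong (allSubsets a) (λ u → ∑ₛ-++ r a (λ vw → g (u ++ vw))) ⟩
    ∑ₛ a (λ u → ∑ₛ r (λ v → ∑ₛ a (λ w → g (u ++ (v ++ w)))))
      ≡⟨ ∑ₗ-cong (allSubsets a) (λ u → ∑ₗ-cong (allSubsets r) (λ v → ∑ₗ-cong (allSubsets a) (g≗h u v))) ⟩
    ∑ₛ a (λ u → ∑ₛ r (λ _ → ∑ₛ a (λ w → h (u ++ w))))
      ≡⟨ ∑ₗ-cong (allSubsets a) (λ u → trans (∑ₛ-const r _) (*-comm _ (2 ^ r))) ⟩
    ∑ₛ a (λ u → 2 ^ r * ∑ₛ a (λ w → h (u ++ w)))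
      ≡⟨ ∑ₗ-*ˡ (allSubsets a) (2 ^ r) _ ⟩
    2 ^ r * ∑ₛ a (λ u → ∑ₛ a (λ w → h (u ++ w)))
      ≡⟨ cong (2 ^ r *_) (sym (∑ₛ-++ a a h)) ⟩
    2 ^ r * ∑ₛ (a + a) h
      ∎
    where open ≡-Reasoning

  hasDiff-insert : ∀ {t r} (u : SubsetOf t) (v : SubsetOf r) (w : SubsetOf t) e → t ≤ e →
    hasDiff (u ++ (v ++ w)) (r + e) ≡ hasDiff (u ++ w) e
  hasDiff-insert {t} {r} u v w e t≤e with m≤n⇒∃[o]m+o≡n t≤e
  ... | f , refl = trans (cong (λ k → anyBelow k (pairs (u ++ (v ++ w)) (r + (t + f)))) range)
                         (anyBelow-cong ((t + t) ∸ (t + f)) pointwise)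
    where
    pairs : ∀ {n} → SubsetOf n → ℕ → ℕ → Bool
    pairs S d x = member S x ∧ member S (x + d)
    range : t + (r + t) ∸ (r + (t + f)) ≡ (t + t) ∸ (t + f)
    range = trans (cong (_∸ (r + (t + f))) (solve 2 (λ t r → t :+ (r :+ t) := r :+ (t :+ t)) refl t r))
                  ([m+n]∸[m+o]≡n∸o r (t + t) (t + f))
    pointwise : ∀ x → x < (t + t) ∸ (t + f) →
      (member (u ++ (v ++ w)) x ∧ member (u ++ (v ++ w)) (x + (r + (t + f)))) ≡ (member (u ++ w) x ∧ member (u ++ w) (x + (t + f)))
    pointwise x x<range = cong₂ _∧_ (trans (member-++ˡ u (v ++ w) x<t) (sym (member-++ˡ u w x<t))) (begin
      member (u ++ (v ++ w)) (x + (r + (t + f)))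
        ≡⟨ cong (member (u ++ (v ++ w))) (solve 4 (λ x r t f → x :+ (r :+ (t :+ f)) := t :+ (r :+ (x :+ f))) refl x r t f) ⟩
      member (u ++ (v ++ w)) (t + (r + (x + f)))
        ≡⟨ member-++ʳ u (v ++ w) (r + (x + f)) ⟩
      member (v ++ w) (r + (x + f))
        ≡⟨ member-++ʳ v w (x + f) ⟩
      member w (x + f)
        ≡⟨ sym (member-++ʳ u w (x + f)) ⟩
      member (u ++ w) (t + (x + f))
        ≡⟨ cong (member (u ++ w)) (solve 3 (λ x t f → t :+ (x :+ f) := x :+ (t :+ f)) refl x t f) ⟩
      member (u ++ w) (x + (t + f))
        ∎)
      where
      open ≡-Reasoning
      x<t : x < t
      x<t = <-≤-trans (subst (x <_) ([m+n]∸[m+o]≡n∸o t t f) x<range) (m∸n≤m t f)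

  hasDiff-halves : ∀ {a} (u w : SubsetOf a) → hasDiff (u ++ w) a ≡ overlaps u w
  hasDiff-halves {a} u w = trans (cong (λ k → anyBelow k (λ x → member (u ++ w) x ∧ member (u ++ w) (x + a))) (m+n∸n≡m a a))
    (anyBelow-cong a (λ x x<a → cong₂ _∧_ (member-++ˡ u w x<a)
      (trans (cong (member (u ++ w)) (+-comm x a)) (member-++ʳ u w x))))

  ∑ₛ-disjoint : ∀ a → ∑ₛ a (λ u → ∑ₛ a (λ w → 𝟙 (not (overlaps u w)))) ≡ 3 ^ a
  ∑ₛ-disjoint zero    = refl
  ∑ₛ-disjoint (suc a) = begin
    ∑ₛ (suc a) (λ u → ∑ₛ (suc a) (λ w → 𝟙 (not (overlaps u w))))
      ≡⟨ ∑ₛ-suc a _ ⟩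
    ∑ₛ a (λ u → ∑ₛ (suc a) (λ w → 𝟙 (not (overlaps (false ∷ u) w))))
      + ∑ₛ a (λ u → ∑ₛ (suc a) (λ w → 𝟙 (not (overlaps (true ∷ u) w))))
      ≡⟨ cong₂ _+_ (∑ₗ-cong (allSubsets a) (λ u → ∑ₛ-suc a _))
                   (∑ₗ-cong (allSubsets a) (λ u → trans (∑ₛ-suc a _) (cong (H u +_) (∑ₛ-const a 0)))) ⟩
    ∑ₛ a (λ u → H u + H u) + ∑ₛ a (λ u → H u + 0)
      ≡⟨ cong₂ _+_ (∑ₗ-+ (allSubsets a) H H) (∑ₗ-cong (allSubsets a) (λ u → +-identityʳ (H u))) ⟩
    (∑ₛ a H + ∑ₛ a H) + ∑ₛ a H
      ≡⟨ cong (λ k → (k + k) + k) (∑ₛ-disjoint a) ⟩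
    (3 ^ a + 3 ^ a) + 3 ^ a
      ≡⟨ solve 1 (λ k → (k :+ k) :+ k := con 3 :* k) refl (3 ^ a) ⟩
    3 ^ suc a
      ∎
    where
    open ≡-Reasoning
    H : SubsetOf a → ℕ
    H u = ∑ₛ a (λ w → 𝟙 (not (overlaps u w)))

  -- The a pairs {x, x + r + a} with x < a are disjoint; each fails to lie inside S in 3
  -- of its 4 configurations, and the r middle points are free.
  absent-exact : ∀ a r → absent (a + (r + a)) (r + a) ≡ 2 ^ r * 3 ^ a
  absent-exact a r = begin
    absent (a + (r + a)) (r + a)
      ≡⟨ ∑ₛ-insert a r _ (λ S → 𝟙 (not (hasDiff S a))) (λ u v w → cong (𝟙 ∘ not) (hasDiff-insert u v w a ≤-refl)) ⟩
    2 ^ r * absent (a + a) a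
      ≡⟨ cong (2 ^ r *_) (∑ₛ-++ a a _) ⟩
    2 ^ r * ∑ₛ a (λ u → ∑ₛ a (λ w → 𝟙 (not (hasDiff (u ++ w) a))))
      ≡⟨ cong (2 ^ r *_) (∑ₗ-cong (allSubsets a) (λ u → ∑ₗ-cong (allSubsets a) (λ w → cong (𝟙 ∘ not) (hasDiff-halves u w)))) ⟩
    2 ^ r * ∑ₛ a (λ u → ∑ₛ a (λ w → 𝟙 (not (overlaps u w))))
      ≡⟨ cong (2 ^ r *_) (∑ₛ-disjoint a) ⟩
    2 ^ r * 3 ^ a
      ∎
    where open ≡-Reasoning

  missingTop-insert : ∀ {t r} (u : SubsetOf t) (v : SubsetOf r) (w : SubsetOf t) →
    missingTop t (u ++ (v ++ w)) ≡ missingTop t (u ++ w)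
  missingTop-insert {t} {r} u v w = ∑-cong t (λ j j<t → cong (𝟙 ∘ not)
    (trans (cong (hasDiff (u ++ (v ++ w))) (regroup j j<t)) (hasDiff-insert u v w ((t + t) ∸ suc j) (t≤ j j<t))))
    where
    regroup : ∀ j → j < t → (t + (r + t)) ∸ suc j ≡ r + ((t + t) ∸ suc j)
    regroup j j<t = trans (cong (_∸ suc j) (solve 2 (λ t r → t :+ (r :+ t) := r :+ (t :+ t)) refl t r))
                          (+-∸-assoc r (≤-trans j<t (m≤m+n t t)))
    t≤ : ∀ j → j < t → t ≤ (t + t) ∸ suc j
    t≤ j j<t = subst (t ≤_) (sym (+-∸-assoc t j<t)) (m≤m+n t _)

  hasDiff-++ʳ : ∀ {a m} (v : SubsetOf a) (R : SubsetOf m) d → T (hasDiff R d) → T (hasDiff (v ++ R) d)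
  hasDiff-++ʳ {a} v R d t with hasDiff⁻ R d t
  ... | y , y∈R , y+d∈R = hasDiff⁺ (v ++ R) d (a + y)
    (subst T (sym (member-++ʳ v R y)) y∈R)
    (subst T (sym (trans (cong (member (v ++ R)) (+-assoc a y d)) (member-++ʳ v R (y + d)))) y+d∈R)

  overlaps⇒hasDiff : ∀ {d m} (u w : SubsetOf d) (R : SubsetOf m) → T (overlaps u w) → T (hasDiff (u ++ (w ++ R)) d)
  overlaps⇒hasDiff {d} u w R t with anyBelow⁻ d _ t
  ... | x , x<d , both with Equivalence.to T-∧ both
  ...   | x∈u , x∈w = hasDiff⁺ (u ++ (w ++ R)) d x
    (subst T (sym (member-++ˡ u (w ++ R) x<d)) x∈u)
    (subst T (sym (trans (cong (member (u ++ (w ++ R))) (+-comm x d))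
                  (trans (member-++ʳ u (w ++ R) x) (member-++ˡ w R x<d)))) x∈w)

  𝟙-absent-++≤ : ∀ {d m} (u w : SubsetOf d) (R : SubsetOf m) →
    𝟙 (not (hasDiff (u ++ (w ++ R)) d)) ≤ 𝟙 (not (overlaps u w)) * 𝟙 (not (hasDiff R d))
  𝟙-absent-++≤ {d} u w R with hasDiff (u ++ (w ++ R)) d in eS
  ... | true  = z≤n
  ... | false with overlaps u w in eo | hasDiff R d in eR
  ...   | false | false = ≤-refl
  ...   | true  | _     = ⊥-elim (subst T eS (overlaps⇒hasDiff u w R (subst T (sym eo) _)))
  ...   | false | true  = ⊥-elim (subst T eS (hasDiff-++ʳ u (w ++ R) d (hasDiff-++ʳ w R d (subst T (sym eR) _))))

  -- Every block of 2d consecutive points contains d disjoint pairs {x, x + d}.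
  absent-block : ∀ d q m → absent (q * (d + d) + m) d ≤ 3 ^ (q * d) * 2 ^ m
  absent-block d zero    m = ≤-trans (∑ₗ-mono (allSubsets m) (λ S → 𝟙≤1 _)) (≤-reflexive (∑ₛ-const m 1))
  absent-block d (suc q) m = begin
    absent (suc q * (d + d) + m) d
      ≡⟨ cong (λ k → absent k d) (solve 3 (λ q d m → (con 1 :+ q) :* (d :+ d) :+ m := d :+ (d :+ (q :* (d :+ d) :+ m))) refl q d m) ⟩
    absent (d + (d + R)) d
      ≡⟨ ∑ₛ-++ d (d + R) _ ⟩
    ∑ₛ d (λ u → ∑ₛ (d + R) (λ wR → 𝟙 (not (hasDiff (u ++ wR) d))))
      ≡⟨ ∑ₗ-cong (allSubsets d) (λ u → ∑ₛ-++ d R _) ⟩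
    ∑ₛ d (λ u → ∑ₛ d (λ w → ∑ₛ R (λ S → 𝟙 (not (hasDiff (u ++ (w ++ S)) d)))))
      ≤⟨ ∑ₗ-mono (allSubsets d) (λ u → ∑ₗ-mono (allSubsets d) (λ w → ∑ₗ-mono (allSubsets R) (𝟙-absent-++≤ u w))) ⟩
    ∑ₛ d (λ u → ∑ₛ d (λ w → ∑ₛ R (λ S → disjoint u w * 𝟙 (not (hasDiff S d)))))
      ≡⟨ ∑ₗ-cong (allSubsets d) (λ u → ∑ₗ-cong (allSubsets d) (λ w → trans (∑ₗ-*ˡ (allSubsets R) (disjoint u w) _) (*-comm (disjoint u w) _))) ⟩
    ∑ₛ d (λ u → ∑ₛ d (λ w → absent R d * disjoint u w))
      ≡⟨ ∑ₗ-cong (allSubsets d) (λ u → ∑ₗ-*ˡ (allSubsets d) (absent R d) (disjoint u)) ⟩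
    ∑ₛ d (λ u → absent R d * ∑ₛ d (disjoint u))
      ≡⟨ ∑ₗ-*ˡ (allSubsets d) (absent R d) _ ⟩
    absent R d * ∑ₛ d (λ u → ∑ₛ d (disjoint u))
      ≡⟨ cong (absent R d *_) (∑ₛ-disjoint d) ⟩
    absent R d * 3 ^ d
      ≤⟨ *-monoˡ-≤ (3 ^ d) (absent-block d q m) ⟩
    3 ^ (q * d) * 2 ^ m * 3 ^ d
      ≡⟨ solve 3 (λ x y z → x :* y :* z := z :* x :* y) refl (3 ^ (q * d)) (2 ^ m) (3 ^ d) ⟩
    3 ^ d * 3 ^ (q * d) * 2 ^ m
      ≡⟨ cong (_* 2 ^ m) (sym (^-distribˡ-+-* 3 d (q * d))) ⟩
    3 ^ (suc q * d) * 2 ^ m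
      ∎
    where
    open ≤-Reasoning
    R = q * (d + d) + m
    disjoint : SubsetOf d → SubsetOf d → ℕ
    disjoint u w = 𝟙 (not (overlaps u w))

  2^[m+m]≡4^m : ∀ m → 2 ^ (m + m) ≡ 4 ^ m
  2^[m+m]≡4^m zero    = refl
  2^[m+m]≡4^m (suc m) = begin
    2 * 2 ^ (m + suc m)     ≡⟨ cong (λ k → 2 * 2 ^ k) (+-suc m m) ⟩
    2 * (2 * 2 ^ (m + m))   ≡⟨ sym (*-assoc 2 2 (2 ^ (m + m))) ⟩
    4 * 2 ^ (m + m)         ≡⟨ cong (4 *_) (2^[m+m]≡4^m m) ⟩
    4 * 4 ^ m               ∎
    where open ≡-Reasoning

  absent-top : ∀ n a → a + a ≤ n → absent n (n ∸ a) * 4 ^ a ≡ 3 ^ a * 2 ^ n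
  absent-top n a a+a≤n with m≤n⇒∃[o]m+o≡n a+a≤n
  ... | r , refl = begin
    absent (a + a + r) (a + a + r ∸ a) * 4 ^ a
      ≡⟨ cong₂ (λ x y → absent x y * 4 ^ a) split (trans (cong (_∸ a) split) (m+n∸m≡n a (r + a))) ⟩
    absent (a + (r + a)) (r + a) * 4 ^ a
      ≡⟨ cong (_* 4 ^ a) (absent-exact a r) ⟩
    2 ^ r * 3 ^ a * 4 ^ a
      ≡⟨ cong (2 ^ r * 3 ^ a *_) (sym (2^[m+m]≡4^m a)) ⟩
    2 ^ r * 3 ^ a * 2 ^ (a + a)
      ≡⟨ solve 3 (λ x y z → x :* y :* z := y :* (z :* x)) refl (2 ^ r) (3 ^ a) (2 ^ (a + a)) ⟩
    3 ^ a * (2 ^ (a + a) * 2 ^ r)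
      ≡⟨ cong (3 ^ a *_) (sym (^-distribˡ-+-* 2 (a + a) r)) ⟩
    3 ^ a * 2 ^ (a + a + r)
      ∎
    where
    open ≡-Reasoning
    split : a + a + r ≡ a + (r + a)
    split = solve 2 (λ a r → a :+ a :+ r := a :+ (r :+ a)) refl a r

  absent-≥half : ∀ n d → d ≤ n → n ≤ d + d → absent n d * 2 ^ n ≡ 3 ^ (n ∸ d) * 4 ^ d
  absent-≥half n d d≤n n≤d+d = *-cancelʳ-≡ _ _ (4 ^ a) {{m^n≢0 4 a}} (begin-equality
    absent n d * 2 ^ n * 4 ^ a
      ≡⟨ solve 3 (λ x y z → x :* y :* z := x :* z :* y) refl (absent n d) (2 ^ n) (4 ^ a) ⟩
    absent n d * 4 ^ a * 2 ^ n
      ≡⟨ cong (λ k → absent n k * 4 ^ a * 2 ^ n) (sym (m∸[m∸n]≡n d≤n)) ⟩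
    absent n (n ∸ a) * 4 ^ a * 2 ^ n
      ≡⟨ cong (_* 2 ^ n) (absent-top n a a+a≤n) ⟩
    3 ^ a * 2 ^ n * 2 ^ n
      ≡⟨ trans (*-assoc (3 ^ a) _ _) (cong (3 ^ a *_) (sym (^-distribˡ-+-* 2 n n))) ⟩
    3 ^ a * 2 ^ (n + n)
      ≡⟨ cong (3 ^ a *_) (2^[m+m]≡4^m n) ⟩
    3 ^ a * 4 ^ n
      ≡⟨ cong (λ k → 3 ^ a * 4 ^ k) (sym (m+[n∸m]≡n d≤n)) ⟩
    3 ^ a * 4 ^ (d + a)
      ≡⟨ cong (3 ^ a *_) (^-distribˡ-+-* 4 d a) ⟩
    3 ^ a * (4 ^ d * 4 ^ a)
      ≡⟨ sym (*-assoc (3 ^ a) _ _) ⟩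
    3 ^ a * 4 ^ d * 4 ^ a
      ∎)
    where
    open ≤-Reasoning
    a = n ∸ d
    a+a≤n : a + a ≤ n
    a+a≤n = begin
      a + a  ≤⟨ +-monoʳ-≤ a (m≤n+o⇒m∸n≤o n d n≤d+d) ⟩
      a + d  ≡⟨ +-comm a d ⟩
      d + a  ≡⟨ m+[n∸m]≡n d≤n ⟩
      n      ∎

  trade-3-for-4 : ∀ a δ y → 3 ^ (a + δ) * 4 ^ y ≤ 3 ^ a * 4 ^ (δ + y)
  trade-3-for-4 a δ y = begin
    3 ^ (a + δ) * 4 ^ y       ≡⟨ cong (_* 4 ^ y) (^-distribˡ-+-* 3 a δ) ⟩
    3 ^ a * 3 ^ δ * 4 ^ y     ≡⟨ *-assoc (3 ^ a) _ _ ⟩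
    3 ^ a * (3 ^ δ * 4 ^ y)   ≤⟨ *-monoʳ-≤ (3 ^ a) (*-monoˡ-≤ (4 ^ y) (^-monoˡ-≤ δ (n≤1+n 3))) ⟩
    3 ^ a * (4 ^ δ * 4 ^ y)   ≡⟨ cong (3 ^ a *_) (sym (^-distribˡ-+-* 4 δ y)) ⟩
    3 ^ a * 4 ^ (δ + y)       ∎
    where open ≤-Reasoning

  halving-blocks : ∀ n d → .{{NonZero d}} → d + d ≤ n → ∃[ q ] ∃[ m ] (q * (d + d) + m ≡ n × n < 4 * (q * d))
  halving-blocks n d@(suc _) 2d≤n = q , m , sym n≡ , (begin-strict
    n
      ≡⟨ n≡ ⟩
    q * (d + d) + m
      <⟨ +-monoʳ-< (q * (d + d)) (m%n<n n (d + d)) ⟩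
    q * (d + d) + (d + d)
      ≤⟨ +-monoʳ-≤ (q * (d + d)) (+-mono-≤ d≤qd d≤qd) ⟩
    q * (d + d) + (q * d + q * d)
      ≡⟨ solve 2 (λ q d → q :* (d :+ d) :+ (q :* d :+ q :* d) := con 4 :* (q :* d)) refl q d ⟩
    4 * (q * d)
      ∎)
    where
    open ≤-Reasoning
    q = n / (d + d)
    m = n % (d + d)
    n≡ : n ≡ q * (d + d) + m
    n≡ = trans (m≡m%n+[m/n]*n n (d + d)) (+-comm m (q * (d + d)))
    1≤q : 1 ≤ q
    1≤q with q in eq
    ... | suc _ = s≤s z≤n
    ... | zero  = ⊥-elim (<⇒≱ (m%n<n n (d + d)) (subst (d + d ≤_) (trans n≡ (cong (λ k → k * (d + d) + m) eq)) 2d≤n))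
    d≤qd : d ≤ q * d
    d≤qd = ≤-trans (≤-reflexive (sym (*-identityˡ d))) (*-monoˡ-≤ d 1≤q)

  absent-<half : ∀ n a d → .{{NonZero d}} → 4 * a ≤ n → d + d ≤ n → absent n d * 2 ^ n ≤ 3 ^ a * 4 ^ (n ∸ a)
  absent-<half n a d 4a≤n 2d≤n with halving-blocks n d 2d≤n
  ... | q , m , refl , n<4e = begin
    absent (q * (d + d) + m) d * 2 ^ (q * (d + d) + m)
      ≤⟨ *-monoˡ-≤ _ (absent-block d q m) ⟩
    3 ^ e * 2 ^ m * 2 ^ (q * (d + d) + m)
      ≡⟨ trans (*-assoc (3 ^ e) _ _) (cong (3 ^ e *_) (sym (^-distribˡ-+-* 2 m _))) ⟩
    3 ^ e * 2 ^ (m + (q * (d + d) + m))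
      ≡⟨ cong (λ k → 3 ^ e * 2 ^ k) (solve 3 (λ q d m → m :+ (q :* (d :+ d) :+ m) := (m :+ q :* d) :+ (m :+ q :* d)) refl q d m) ⟩
    3 ^ e * 2 ^ ((m + e) + (m + e))
      ≡⟨ cong (3 ^ e *_) (2^[m+m]≡4^m (m + e)) ⟩
    3 ^ e * 4 ^ (m + e)
      ≡⟨ cong (λ k → 3 ^ k * 4 ^ (m + k)) (sym a+δ≡e) ⟩
    3 ^ (a + δ) * 4 ^ (m + (a + δ))
      ≤⟨ trade-3-for-4 a δ (m + (a + δ)) ⟩
    3 ^ a * 4 ^ (δ + (m + (a + δ)))
      ≡⟨ cong (λ k → 3 ^ a * 4 ^ k) (sym (trans (cong (_∸ a) n≡) (m+n∸m≡n a _))) ⟩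
    3 ^ a * 4 ^ (q * (d + d) + m ∸ a)
      ∎
    where
    open ≤-Reasoning
    e = q * d
    δ = e ∸ a
    a+δ≡e : a + δ ≡ e
    a+δ≡e = m+[n∸m]≡n (*-cancelˡ-≤ {a} {e} 4 (≤-trans 4a≤n (<⇒≤ n<4e)))
    n≡ : q * (d + d) + m ≡ a + (δ + (m + (a + δ)))
    n≡ = begin-equality
      q * (d + d) + m
        ≡⟨ cong (_+ m) (*-distribˡ-+ q d d) ⟩
      e + e + m
        ≡⟨ cong (λ k → k + k + m) (sym a+δ≡e) ⟩
      (a + δ) + (a + δ) + m
        ≡⟨ solve 3 (λ a δ m → (a :+ δ) :+ (a :+ δ) :+ m := a :+ (δ :+ (m :+ (a :+ δ)))) refl a δ m ⟩
      a + (δ + (m + (a + δ)))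
        ∎

  absent-bound : ∀ n a d → .{{NonZero d}} → 4 * a ≤ n → d ≤ n →
    absent n d * 2 ^ n ≤ 3 ^ a * 4 ^ (n ∸ a) + 3 ^ (n ∸ d) * 4 ^ d
  absent-bound n a d 4a≤n d≤n with d + d ≤? n
  ... | yes 2d≤n = ≤-trans (absent-<half n a d 4a≤n 2d≤n) (m≤m+n _ _)
  ... | no  2d≰n = ≤-trans (≤-reflexive (absent-≥half n d d≤n (<⇒≤ (≰⇒> 2d≰n)))) (m≤n+m _ _)

  geometric : ∀ m → ∑ m (λ i → 3 ^ i * 4 ^ (m ∸ suc i)) + 3 ^ m ≡ 4 ^ m
  geometric zero    = refl
  geometric (suc m) = begin
    (1 * 4 ^ m + ∑ m (λ i → 3 ^ suc i * 4 ^ (m ∸ suc i))) + 3 ^ suc m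
      ≡⟨ cong (λ x → (1 * 4 ^ m + x) + 3 ^ suc m) (trans (∑-cong m (λ i _ → *-assoc 3 (3 ^ i) _)) (∑-*ˡ m 3 g)) ⟩
    (1 * 4 ^ m + 3 * ∑ m g) + 3 * 3 ^ m
      ≡⟨ solve 3 (λ x y z → (con 1 :* z :+ con 3 :* x) :+ con 3 :* y := z :+ con 3 :* (x :+ y)) refl (∑ m g) (3 ^ m) (4 ^ m) ⟩
    4 ^ m + 3 * (∑ m g + 3 ^ m)
      ≡⟨ cong (λ x → 4 ^ m + 3 * x) (geometric m) ⟩
    4 ^ m + 3 * 4 ^ m
      ≡⟨ solve 1 (λ z → z :+ con 3 :* z := con 4 :* z) refl (4 ^ m) ⟩
    4 ^ suc m
      ∎
    where
    open ≡-Reasoning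
    g : ℕ → ℕ
    g i = 3 ^ i * 4 ^ (m ∸ suc i)

  lowGapCount : ℕ → ℕ → ℕ
  lowGapCount n t = ∑ₛ n (𝟙 ∘ missesLow t)

  lowGapCount≤∑absent : ∀ t L → lowGapCount (t + 1 + L) t ≤ ∑ L (λ i → absent (t + 1 + L) (suc i))
  lowGapCount≤∑absent t L = begin
    lowGapCount n t                                        ≤⟨ ∑ₗ-mono (allSubsets n) union-bound ⟩
    ∑ₛ n (λ S → ∑ L (λ i → 𝟙 (not (hasDiff S (suc i)))))  ≡⟨ ∑ₛ-∑ n L _ ⟩
    ∑ L (λ i → absent n (suc i))                           ∎
    where
    open ≤-Reasoning
    n = t + 1 + L
    n∸1∸t≡L : n ∸ 1 ∸ t ≡ L
    n∸1∸t≡L = begin-equality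
      t + 1 + L ∸ 1 ∸ t
        ≡⟨ cong (λ k → k ∸ 1 ∸ t) (solve 2 (λ t L → t :+ con 1 :+ L := con 1 :+ (t :+ L)) refl t L) ⟩
      1 + (t + L) ∸ 1 ∸ t
        ≡⟨ cong (_∸ t) (m+n∸m≡n 1 (t + L)) ⟩
      t + L ∸ t
        ≡⟨ m+n∸m≡n t L ⟩
      L
        ∎
    union-bound : ∀ S → 𝟙 (missesLow t S) ≤ ∑ L (λ i → 𝟙 (not (hasDiff S (suc i))))
    union-bound S = subst (λ k → 𝟙 (missesLow t S) ≤ ∑ k (λ i → 𝟙 (not (hasDiff S (suc i))))) n∸1∸t≡L
      (𝟙-anyBelow≤∑ (n ∸ 1 ∸ t) _)

  geometric-tail : ∀ t L → ∑ L (λ i → 3 ^ (t + 1 + L ∸ suc i) * 4 ^ suc i) ≤ 3 ^ (t + 1) * 4 ^ suc L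
  geometric-tail t L = begin
    ∑ L (λ i → 3 ^ (n ∸ suc i) * 4 ^ suc i)
      ≡⟨ sym (∑-reverse L _) ⟩
    ∑ L (λ i → 3 ^ (n ∸ suc (L ∸ suc i)) * 4 ^ suc (L ∸ suc i))
      ≡⟨ ∑-cong L reversed ⟩
    ∑ L (λ i → 4 * 3 ^ (t + 1) * (3 ^ i * 4 ^ (L ∸ suc i)))
      ≡⟨ ∑-*ˡ L (4 * 3 ^ (t + 1)) _ ⟩
    4 * 3 ^ (t + 1) * ∑ L (λ i → 3 ^ i * 4 ^ (L ∸ suc i))
      ≤⟨ *-monoʳ-≤ (4 * 3 ^ (t + 1)) (≤-trans (m≤m+n _ _) (≤-reflexive (geometric L))) ⟩
    4 * 3 ^ (t + 1) * 4 ^ L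
      ≡⟨ solve 2 (λ x y → con 4 :* x :* y := x :* (con 4 :* y)) refl (3 ^ (t + 1)) (4 ^ L) ⟩
    3 ^ (t + 1) * 4 ^ suc L
      ∎
    where
    open ≤-Reasoning
    n = t + 1 + L
    reversed : ∀ i → i < L → 3 ^ (n ∸ suc (L ∸ suc i)) * 4 ^ suc (L ∸ suc i) ≡ 4 * 3 ^ (t + 1) * (3 ^ i * 4 ^ (L ∸ suc i))
    reversed i i<L = begin-equality
      3 ^ (n ∸ suc (L ∸ suc i)) * (4 * 4 ^ (L ∸ suc i))
        ≡⟨ cong (λ k → 3 ^ k * (4 * 4 ^ (L ∸ suc i))) exponent ⟩
      3 ^ (t + 1 + i) * (4 * 4 ^ (L ∸ suc i))
        ≡⟨ cong (_* (4 * 4 ^ (L ∸ suc i))) (^-distribˡ-+-* 3 (t + 1) i) ⟩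
      3 ^ (t + 1) * 3 ^ i * (4 * 4 ^ (L ∸ suc i))
        ≡⟨ solve 3 (λ x y z → x :* y :* (con 4 :* z) := con 4 :* x :* (y :* z)) refl (3 ^ (t + 1)) (3 ^ i) (4 ^ (L ∸ suc i)) ⟩
      4 * 3 ^ (t + 1) * (3 ^ i * 4 ^ (L ∸ suc i))
        ∎
      where
      exponent : n ∸ suc (L ∸ suc i) ≡ t + 1 + i
      exponent = begin-equality
        t + 1 + L ∸ suc (L ∸ suc i)   ≡⟨ cong (t + 1 + L ∸_) (sym (+-∸-assoc 1 i<L)) ⟩
        t + 1 + L ∸ (L ∸ i)           ≡⟨ +-∸-assoc (t + 1) (m∸n≤m L i) ⟩
        t + 1 + (L ∸ (L ∸ i))         ≡⟨ cong (t + 1 +_) (m∸[m∸n]≡n (<⇒≤ i<L)) ⟩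
        t + 1 + i                     ∎

  lowGapCount-bound : ∀ t L a → 4 * a ≤ t + 1 + L →
    lowGapCount (t + 1 + L) t * 2 ^ (t + 1 + L) ≤ L * (3 ^ a * 4 ^ (t + 1 + L ∸ a)) + 3 ^ (t + 1) * 4 ^ suc L
  lowGapCount-bound t L a 4a≤n = begin
    lowGapCount n t * 2 ^ n
      ≤⟨ *-monoˡ-≤ (2 ^ n) (lowGapCount≤∑absent t L) ⟩
    ∑ L (λ i → absent n (suc i)) * 2 ^ n
      ≡⟨ trans (*-comm _ (2 ^ n)) (sym (∑-*ˡ L (2 ^ n) _)) ⟩
    ∑ L (λ i → 2 ^ n * absent n (suc i))
      ≤⟨ ∑-mono L (λ i i<L → ≤-trans (≤-reflexive (*-comm (2 ^ n) _)) (absent-bound n a (suc i) 4a≤n (≤-trans i<L (m≤n+m L (t + 1))))) ⟩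
    ∑ L (λ i → W + 3 ^ (n ∸ suc i) * 4 ^ suc i)
      ≡⟨ trans (∑-+ L (λ _ → W) _) (cong (_+ ∑ L (λ i → 3 ^ (n ∸ suc i) * 4 ^ suc i)) (∑-const L W)) ⟩
    L * W + ∑ L (λ i → 3 ^ (n ∸ suc i) * 4 ^ suc i)
      ≤⟨ +-monoʳ-≤ (L * W) (geometric-tail t L) ⟩
    L * W + 3 ^ (t + 1) * 4 ^ suc L
      ∎
    where
    open ≤-Reasoning
    n = t + 1 + L
    W = 3 ^ a * 4 ^ (n ∸ a)

  -- Powers of 3/4 beat polynomials

  -- P(n) = n² + 5n + 18 satisfies 3 P(n + 1) ≤ 4 P(n).
  3^n*quadratic≤18*4^n : ∀ n → 3 ^ n * (n * n + 5 * n + 18) ≤ 18 * 4 ^ n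
  3^n*quadratic≤18*4^n zero    = ≤-refl
  3^n*quadratic≤18*4^n (suc n) = begin
    3 ^ suc n * P (suc n)   ≡⟨ solve 2 (λ x y → (con 3 :* x) :* y := x :* (con 3 :* y)) refl (3 ^ n) (P (suc n)) ⟩
    3 ^ n * (3 * P (suc n)) ≤⟨ *-monoʳ-≤ (3 ^ n) (step n) ⟩
    3 ^ n * (4 * P n)       ≡⟨ solve 2 (λ x y → x :* (con 4 :* y) := con 4 :* (x :* y)) refl (3 ^ n) (P n) ⟩
    4 * (3 ^ n * P n)       ≤⟨ *-monoʳ-≤ 4 (3^n*quadratic≤18*4^n n) ⟩
    4 * (18 * 4 ^ n)        ≡⟨ solve 1 (λ x → con 4 :* (con 18 :* x) := con 18 :* (con 4 :* x)) refl (4 ^ n) ⟩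
    18 * 4 ^ suc n          ∎
    where
    open ≤-Reasoning
    P : ℕ → ℕ
    P m = m * m + 5 * m + 18
    step : ∀ m → 3 * P (suc m) ≤ 4 * P m
    step zero    = ≤-refl
    step (suc m) = ≤-trans (m≤m+n _ (m * suc m)) (≤-reflexive (solve 1 (λ m →
      con 3 :* ((con 2 :+ m) :* (con 2 :+ m) :+ con 5 :* (con 2 :+ m) :+ con 18) :+ m :* (con 1 :+ m)
        := con 4 :* ((con 1 :+ m) :* (con 1 :+ m) :+ con 5 :* (con 1 :+ m) :+ con 18)) refl m))

  C*n*3^n≤4^n : ∀ C n → 18 * C ≤ n → C * n * 3 ^ n ≤ 4 ^ n
  C*n*3^n≤4^n C n 18C≤n = *-cancelˡ-≤ 18 (begin
    18 * (C * n * 3 ^ n)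
      ≡⟨ solve 3 (λ C n x → con 18 :* (C :* n :* x) := (con 18 :* C) :* n :* x) refl C n (3 ^ n) ⟩
    18 * C * n * 3 ^ n
      ≤⟨ *-monoˡ-≤ (3 ^ n) (*-monoˡ-≤ n 18C≤n) ⟩
    n * n * 3 ^ n
      ≤⟨ ≤-trans (≤-reflexive (*-comm (n * n) _)) (*-monoʳ-≤ (3 ^ n) (≤-trans (m≤m+n (n * n) (5 * n)) (m≤m+n _ 18))) ⟩
    3 ^ n * (n * n + 5 * n + 18)
      ≤⟨ 3^n*quadratic≤18*4^n n ⟩
    18 * 4 ^ n
      ∎)
    where open ≤-Reasoning

  C*3^n≤4^n : ∀ C n → 18 * C < n → C * 3 ^ n ≤ 4 ^ n
  C*3^n≤4^n C n 18C<n = begin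
    C * 3 ^ n
      ≤⟨ *-monoˡ-≤ (3 ^ n) (≤-trans (≤-reflexive (sym (*-identityʳ C))) (*-monoʳ-≤ C (≤-trans (s≤s z≤n) 18C<n))) ⟩
    C * n * 3 ^ n
      ≤⟨ C*n*3^n≤4^n C n (<⇒≤ 18C<n) ⟩
    4 ^ n
      ∎
    where open ≤-Reasoning

  eventually-C*n*3^a≤4^a : ∀ C → ∃[ N ] (∀ n → N ≤ n → ∃[ a ] (4 * a ≤ n × C * n * 3 ^ a ≤ 4 ^ a))
  eventually-C*n*3^a≤4^a C = 4 * K , λ n 4K≤n → n / 4 , 4[n/4]≤n n , bound n 4K≤n
    where
    K = suc (18 * (7 * C))
    n≡ : ∀ n → n ≡ 4 * (n / 4) + n % 4
    n≡ n = trans (m≡m%n+[m/n]*n n 4) (trans (+-comm (n % 4) _) (cong (_+ n % 4) (*-comm (n / 4) 4)))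
    4[n/4]≤n : ∀ n → 4 * (n / 4) ≤ n
    4[n/4]≤n n = subst (4 * (n / 4) ≤_) (sym (n≡ n)) (m≤m+n _ _)
    n<4[n/4]+4 : ∀ n → n < 4 * (n / 4) + 4
    n<4[n/4]+4 n = subst (_< 4 * (n / 4) + 4) (sym (n≡ n)) (+-monoʳ-< (4 * (n / 4)) (m%n<n n 4))
    K≤n/4 : ∀ n → 4 * K ≤ n → K ≤ n / 4
    K≤n/4 n 4K≤n = ≤-pred (*-cancelˡ-< 4 K (suc (n / 4)) (begin-strict
      4 * K                ≤⟨ 4K≤n ⟩
      n                    <⟨ n<4[n/4]+4 n ⟩
      4 * (n / 4) + 4      ≡⟨ solve 1 (λ a → con 4 :* a :+ con 4 := con 4 :* (con 1 :+ a)) refl (n / 4) ⟩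
      4 * suc (n / 4)      ∎))
      where open ≤-Reasoning
    bound : ∀ n → 4 * K ≤ n → C * n * 3 ^ (n / 4) ≤ 4 ^ (n / 4)
    bound n 4K≤n = begin
      C * n * 3 ^ a          ≤⟨ *-monoˡ-≤ (3 ^ a) (*-monoʳ-≤ C n≤7a) ⟩
      C * (7 * a) * 3 ^ a    ≡⟨ cong (_* 3 ^ a) (solve 2 (λ C a → C :* (con 7 :* a) := con 7 :* C :* a) refl C a) ⟩
      7 * C * a * 3 ^ a      ≤⟨ C*n*3^n≤4^n (7 * C) a (≤-trans (n≤1+n _) (K≤n/4 n 4K≤n)) ⟩
      4 ^ a                  ∎
      where
      open ≤-Reasoning
      a = n / 4
      1≤a : 1 ≤ a
      1≤a = ≤-trans (s≤s z≤n) (K≤n/4 n 4K≤n)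
      n≤7a : n ≤ 7 * a
      n≤7a = begin
        n             ≤⟨ ≤-pred (subst (n <_) (+-suc (4 * a) 3) (n<4[n/4]+4 n)) ⟩
        4 * a + 3     ≤⟨ +-monoʳ-≤ (4 * a) (*-monoʳ-≤ 3 1≤a) ⟩
        4 * a + 3 * a ≡⟨ solve 1 (λ a → con 4 :* a :+ con 3 :* a := con 7 :* a) refl a ⟩
        7 * a         ∎

  -- Small differences are rarely missing

  lowGapCount-small : ∀ C t L a → 4 * a ≤ t + 1 + L → 2 * C * (t + 1 + L) * 3 ^ a ≤ 4 ^ a →
    8 * C * 3 ^ (t + 1) ≤ 4 ^ (t + 1) → C * lowGapCount (t + 1 + L) t ≤ 2 ^ (t + 1 + L)
  lowGapCount-small C t L a 4a≤n many-blocks long-top = *-cancelʳ-≤ (C * lowGapCount n t) (2 ^ n) (2 ^ n) {{m^n≢0 2 n}} (begin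
    C * lowGapCount n t * 2 ^ n
      ≡⟨ *-assoc C _ _ ⟩
    C * (lowGapCount n t * 2 ^ n)
      ≤⟨ *-monoʳ-≤ C (lowGapCount-bound t L a 4a≤n) ⟩
    C * (L * W + 3 ^ (t + 1) * 4 ^ suc L)
      ≡⟨ *-distribˡ-+ C _ _ ⟩
    X + Y
      ≤⟨ *-cancelˡ-≤ 2 (begin
           2 * (X + Y)     ≡⟨ *-distribˡ-+ 2 X Y ⟩
           2 * X + 2 * Y   ≤⟨ +-mono-≤ 2X≤4^n 2Y≤4^n ⟩
           4 ^ n + 4 ^ n   ≡⟨ cong (4 ^ n +_) (sym (+-identityʳ (4 ^ n))) ⟩
           2 * 4 ^ n       ∎) ⟩
    4 ^ n
      ≡⟨ trans (sym (2^[m+m]≡4^m n)) (^-distribˡ-+-* 2 n n) ⟩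
    2 ^ n * 2 ^ n
      ∎)
    where
    open ≤-Reasoning
    n = t + 1 + L
    W = 3 ^ a * 4 ^ (n ∸ a)
    X = C * (L * W)
    Y = C * (3 ^ (t + 1) * 4 ^ suc L)
    a≤n : a ≤ n
    a≤n = ≤-trans (m≤n*m a 4) 4a≤n
    2X≤4^n : 2 * X ≤ 4 ^ n
    2X≤4^n = begin
      2 * (C * (L * (3 ^ a * 4 ^ (n ∸ a))))
        ≡⟨ solve 4 (λ C L x y → con 2 :* (C :* (L :* (x :* y))) := con 2 :* C :* L :* x :* y) refl C L (3 ^ a) (4 ^ (n ∸ a)) ⟩
      2 * C * L * 3 ^ a * 4 ^ (n ∸ a)
        ≤⟨ *-monoˡ-≤ (4 ^ (n ∸ a)) (*-monoˡ-≤ (3 ^ a) (*-monoʳ-≤ (2 * C) (m≤n+m L (t + 1)))) ⟩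
      2 * C * n * 3 ^ a * 4 ^ (n ∸ a)
        ≤⟨ *-monoˡ-≤ (4 ^ (n ∸ a)) many-blocks ⟩
      4 ^ a * 4 ^ (n ∸ a)
        ≡⟨ trans (sym (^-distribˡ-+-* 4 a (n ∸ a))) (cong (4 ^_) (m+[n∸m]≡n a≤n)) ⟩
      4 ^ n
        ∎
    2Y≤4^n : 2 * Y ≤ 4 ^ n
    2Y≤4^n = begin
      2 * (C * (3 ^ (t + 1) * 4 ^ suc L))
        ≡⟨ solve 3 (λ C x y → con 2 :* (C :* (x :* (con 4 :* y))) := con 8 :* C :* x :* y) refl C (3 ^ (t + 1)) (4 ^ L) ⟩
      8 * C * 3 ^ (t + 1) * 4 ^ L
        ≤⟨ *-monoˡ-≤ (4 ^ L) long-top ⟩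
      4 ^ (t + 1) * 4 ^ L
        ≡⟨ sym (^-distribˡ-+-* 4 (t + 1) L) ⟩
      4 ^ n
        ∎

  lowGapCount-eventually-small : ∀ C t → 8 * C * 3 ^ (t + 1) ≤ 4 ^ (t + 1) →
    ∃[ N ] (∀ n → N ≤ n → C * lowGapCount n t ≤ 2 ^ n)
  lowGapCount-eventually-small C t long-top = N₀ + (t + 1) , rare
    where
    blocks : ∃[ N ] (∀ n → N ≤ n → ∃[ a ] (4 * a ≤ n × 2 * C * n * 3 ^ a ≤ 4 ^ a))
    blocks = eventually-C*n*3^a≤4^a (2 * C)
    N₀ = proj₁ blocks
    rare : ∀ n → N₀ + (t + 1) ≤ n → C * lowGapCount n t ≤ 2 ^ n
    rare n N≤n = subst (λ m → C * lowGapCount m t ≤ 2 ^ m) n≡ (lowGapCount-small C t L a 4a≤n many-blocks long-top)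
      where
      L = n ∸ (t + 1)
      n≡ : t + 1 + L ≡ n
      n≡ = m+[n∸m]≡n (≤-trans (m≤n+m (t + 1) N₀) N≤n)
      choice : ∃[ a ] (4 * a ≤ n × 2 * C * n * 3 ^ a ≤ 4 ^ a)
      choice = proj₂ blocks n (≤-trans (m≤m+n N₀ _) N≤n)
      a = proj₁ choice
      4a≤n : 4 * a ≤ t + 1 + L
      4a≤n = subst (4 * a ≤_) (sym n≡) (proj₁ (proj₂ choice))
      many-blocks : 2 * C * (t + 1 + L) * 3 ^ a ≤ 4 ^ a
      many-blocks = subst (λ m → 2 * C * m * 3 ^ a ≤ 4 ^ a) (sym n≡) (proj₂ (proj₂ choice))

  -- truncate K x is x for x < K and 0 otherwise, written the way partialMean sums.
  truncate : ℕ → ℕ → ℕ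
  truncate K x = ∑ K (λ i → i * 𝟙 ⌊ x ≟ i ⌋)

  ∑-pick : ∀ K (g : ℕ → ℕ) x → x < K → ∑ K (λ i → g i * 𝟙 ⌊ x ≟ i ⌋) ≡ g x
  ∑-pick (suc K) g zero    _         = begin-equality
    g 0 * 1 + ∑ K (λ i → g (suc i) * 0)
      ≡⟨ cong₂ _+_ (*-identityʳ (g 0)) (∑-cong K (λ i _ → *-zeroʳ (g (suc i)))) ⟩
    g 0 + ∑ K (λ _ → 0)
      ≡⟨ cong (g 0 +_) (trans (∑-const K 0) (*-zeroʳ K)) ⟩
    g 0 + 0
      ≡⟨ +-identityʳ (g 0) ⟩
    g 0
      ∎
    where open ≤-Reasoning
  ∑-pick (suc K) g (suc x) (s≤s x<K) = begin-equality
    g 0 * 0 + ∑ K (λ i → g (suc i) * 𝟙 ⌊ suc x ≟ suc i ⌋)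
      ≡⟨ cong (_+ ∑ K (λ i → g (suc i) * 𝟙 ⌊ suc x ≟ suc i ⌋)) (*-zeroʳ (g 0)) ⟩
    ∑ K (λ i → g (suc i) * 𝟙 ⌊ suc x ≟ suc i ⌋)
      ≡⟨ ∑-cong K (λ i _ → cong (λ b → g (suc i) * 𝟙 b) (⌊suc≟suc⌋ x i)) ⟩
    ∑ K (λ i → g (suc i) * 𝟙 ⌊ x ≟ i ⌋)
      ≡⟨ ∑-pick K (g ∘ suc) x x<K ⟩
    g (suc x)
      ∎
    where
    open ≤-Reasoning
    ⌊suc≟suc⌋ : ∀ x i → ⌊ suc x ≟ suc i ⌋ ≡ ⌊ x ≟ i ⌋
    ⌊suc≟suc⌋ x i = trans (isYes≗does (suc x ≟ suc i)) (sym (isYes≗does (x ≟ i)))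

  ∑-pick-none : ∀ K (g : ℕ → ℕ) x → K ≤ x → ∑ K (λ i → g i * 𝟙 ⌊ x ≟ i ⌋) ≡ 0
  ∑-pick-none K g x K≤x = trans (∑-cong K (λ i i<K → trans (cong (λ b → g i * 𝟙 b) (x≟i-false i<K)) (*-zeroʳ (g i))))
                                (trans (∑-const K 0) (*-zeroʳ K))
    where
    x≟i-false : ∀ {i} → i < K → ⌊ x ≟ i ⌋ ≡ false
    x≟i-false {i} i<K = trans (isYes≗does (x ≟ i)) (dec-false (x ≟ i) (λ { refl → <⇒≱ i<K K≤x }))

  truncate-< : ∀ K x → x < K → truncate K x ≡ x
  truncate-< K x = ∑-pick K (λ i → i) x

  truncate-≥ : ∀ K x → K ≤ x → truncate K x ≡ 0
  truncate-≥ K x = ∑-pick-none K (λ i → i) x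

  truncate≤id : ∀ K x → truncate K x ≤ x
  truncate≤id K x with x <? K
  ... | yes x<K = ≤-reflexive (truncate-< K x x<K)
  ... | no  x≮K = ≤-trans (≤-reflexive (truncate-≥ K x (≮⇒≥ x≮K))) z≤n

  truncate≤K : ∀ K x → truncate K x ≤ K
  truncate≤K K x with x <? K
  ... | yes x<K = ≤-trans (≤-reflexive (truncate-< K x x<K)) (<⇒≤ x<K)
  ... | no  x≮K = ≤-trans (≤-reflexive (truncate-≥ K x (≮⇒≥ x≮K))) z≤n

  ≤-unless : ∀ (φ : ℕ → ℕ) B → (∀ x → φ x ≤ B) → ∀ x y b → (b ≡ false → x ≡ y) → φ x ≤ φ y + B * 𝟙 b
  ≤-unless φ B φ≤B x y true  _   = ≤-trans (φ≤B x) (≤-trans (≤-reflexive (sym (*-identityʳ B))) (m≤n+m _ _))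
  ≤-unless φ B φ≤B x y false x≡y = ≤-trans (≤-reflexive (cong φ (x≡y refl))) (m≤m+n _ _)

  ∑ₛ-≤-unless : ∀ n (φ : ℕ → ℕ) B → (∀ x → φ x ≤ B) → (f g : SubsetOf n → ℕ) (bad : SubsetOf n → Bool) →
    (∀ S → bad S ≡ false → f S ≡ g S) → ∑ₛ n (φ ∘ f) ≤ ∑ₛ n (φ ∘ g) + B * ∑ₛ n (𝟙 ∘ bad)
  ∑ₛ-≤-unless n φ B φ≤B f g bad f≡g = begin
    ∑ₛ n (φ ∘ f)
      ≤⟨ ∑ₗ-mono (allSubsets n) (λ S → ≤-unless φ B φ≤B (f S) (g S) (bad S) (f≡g S)) ⟩
    ∑ₛ n (λ S → φ (g S) + B * 𝟙 (bad S))
      ≡⟨ ∑ₗ-+ (allSubsets n) (φ ∘ g) _ ⟩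
    ∑ₛ n (φ ∘ g) + ∑ₛ n (λ S → B * 𝟙 (bad S))
      ≡⟨ cong (∑ₛ n (φ ∘ g) +_) (∑ₗ-*ˡ (allSubsets n) B (𝟙 ∘ bad)) ⟩
    ∑ₛ n (φ ∘ g) + B * ∑ₛ n (𝟙 ∘ bad)
      ∎
    where open ≤-Reasoning

  -- If 2(A + U) ≥ K > 2J ≥ 2A then U ≥ 1, and then 2(A + U) ≤ (2J + 2) U.
  double-truncate : ∀ A U J K → A ≤ J → J + J < K → (A + U) + (A + U) ≤ truncate K ((A + U) + (A + U)) + (J + J + 2) * U
  double-truncate A U J K A≤J 2J<K with (A + U) + (A + U) <? K
  ... | yes small = ≤-trans (≤-reflexive (sym (truncate-< K _ small))) (m≤m+n _ _)
  ... | no  large = ≤-trans (big U large) (m≤n+m _ _)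
    where
    big : ∀ U → ¬ ((A + U) + (A + U) < K) → (A + U) + (A + U) ≤ (J + J + 2) * U
    big zero    large = ⊥-elim (large (≤-<-trans (+-mono-≤ A+0≤J A+0≤J) 2J<K))
      where
      A+0≤J : A + 0 ≤ J
      A+0≤J = subst (_≤ J) (sym (+-identityʳ A)) A≤J
    big (suc U) _     = begin
      (A + suc U) + (A + suc U)                          ≤⟨ +-mono-≤ (+-monoˡ-≤ (suc U) A≤J) (+-monoˡ-≤ (suc U) A≤J) ⟩
      (J + suc U) + (J + suc U)                          ≤⟨ m≤m+n _ (J * U + J * U) ⟩
      (J + suc U) + (J + suc U) + (J * U + J * U)        ≡⟨ solve 2 (λ J U → (J :+ (con 1 :+ U)) :+ (J :+ (con 1 :+ U)) :+ (J :* U :+ J :* U)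
                                                                            := (J :+ J :+ con 2) :* (con 1 :+ U)) refl J U ⟩
      (J + J + 2) * suc U                                ∎
      where open ≤-Reasoning

  missingCount : ℕ → ℕ → ℕ
  missingCount n k = ∑ₛ n (λ S → 𝟙 ⌊ missing S ≟ k ⌋)

  countMissing≡missingCount : ∀ n k → countMissing n k ≡ missingCount n k
  countMissing≡missingCount n k = length-filterᵇ (λ S → ⌊ missing S ≟ k ⌋) (allSubsets n)

  topCount : ℕ → ℕ → ℕ → ℕ
  topCount n t k = ∑ₛ n (λ S → 𝟙 ⌊ missingTop t S + missingTop t S ≟ k ⌋)

  topCount-insert : ∀ t r k → topCount (t + (r + t)) t k ≡ 2 ^ r * topCount (t + t) t k
  topCount-insert t r k = ∑ₛ-insert t r _ _ (λ u v w → cong (λ z → 𝟙 ⌊ z + z ≟ k ⌋) (missingTop-insert u v w))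

  ∑ₛ-missingWindow : ∀ n J m → (J + m) + (J + m) ≤ n →
    ∑ₛ n (λ S → missingWindow S J m) * 4 ^ (J + m) ≡ 2 ^ n * (3 ^ suc J * ∑ m (λ i → 3 ^ i * 4 ^ (m ∸ suc i)))
  ∑ₛ-missingWindow n J m 2[J+m]≤n = begin-equality
    ∑ₛ n (λ S → missingWindow S J m) * 4 ^ (J + m)
      ≡⟨ cong (_* 4 ^ (J + m)) (∑ₛ-∑ n m _) ⟩
    ∑ m (λ i → absent n (n ∸ suc (J + i))) * 4 ^ (J + m)
      ≡⟨ trans (*-comm _ (4 ^ (J + m))) (sym (∑-*ˡ m (4 ^ (J + m)) _)) ⟩
    ∑ m (λ i → 4 ^ (J + m) * absent n (n ∸ suc (J + i)))
      ≡⟨ ∑-cong m term ⟩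
    ∑ m (λ i → 2 ^ n * (3 ^ suc J * (3 ^ i * 4 ^ (m ∸ suc i))))
      ≡⟨ ∑-*ˡ m (2 ^ n) _ ⟩
    2 ^ n * ∑ m (λ i → 3 ^ suc J * (3 ^ i * 4 ^ (m ∸ suc i)))
      ≡⟨ cong (2 ^ n *_) (∑-*ˡ m (3 ^ suc J) _) ⟩
    2 ^ n * (3 ^ suc J * ∑ m (λ i → 3 ^ i * 4 ^ (m ∸ suc i)))
      ∎
    where
    open ≤-Reasoning
    term : ∀ i → i < m → 4 ^ (J + m) * absent n (n ∸ suc (J + i)) ≡ 2 ^ n * (3 ^ suc J * (3 ^ i * 4 ^ (m ∸ suc i)))
    term i i<m = begin-equality
      4 ^ (J + m) * absent n (n ∸ a)
        ≡⟨ cong (λ k → 4 ^ k * absent n (n ∸ a)) J+m≡a+r ⟩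
      4 ^ (a + r) * absent n (n ∸ a)
        ≡⟨ cong (_* absent n (n ∸ a)) (^-distribˡ-+-* 4 a r) ⟩
      4 ^ a * 4 ^ r * absent n (n ∸ a)
        ≡⟨ solve 3 (λ x y z → x :* y :* z := z :* x :* y) refl (4 ^ a) (4 ^ r) (absent n (n ∸ a)) ⟩
      absent n (n ∸ a) * 4 ^ a * 4 ^ r
        ≡⟨ cong (_* 4 ^ r) (absent-top n a a+a≤n) ⟩
      3 ^ a * 2 ^ n * 4 ^ r
        ≡⟨ cong (λ x → x * 2 ^ n * 4 ^ r) (^-distribˡ-+-* 3 (suc J) i) ⟩
      3 ^ suc J * 3 ^ i * 2 ^ n * 4 ^ r
        ≡⟨ solve 4 (λ x y z w → x :* y :* z :* w := z :* (x :* (y :* w))) refl (3 ^ suc J) (3 ^ i) (2 ^ n) (4 ^ r) ⟩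
      2 ^ n * (3 ^ suc J * (3 ^ i * 4 ^ r))
        ∎
      where
      a = suc (J + i)
      r = m ∸ suc i
      J+m≡a+r : J + m ≡ a + r
      J+m≡a+r = begin-equality
        J + m                 ≡⟨ cong (J +_) (sym (m+[n∸m]≡n i<m)) ⟩
        J + (suc i + r)       ≡⟨ sym (+-assoc J (suc i) r) ⟩
        J + suc i + r         ≡⟨ cong (_+ r) (+-suc J i) ⟩
        a + r                 ∎
      a≤J+m : a ≤ J + m
      a≤J+m = subst (a ≤_) (sym J+m≡a+r) (m≤m+n a r)
      a+a≤n : a + a ≤ n
      a+a≤n = ≤-trans (+-mono-≤ a≤J+m a≤J+m) 2[J+m]≤n

  ∑ₛ-missingTop : ∀ n t → t + t ≤ n → ∑ₛ n (missingTop t) * 4 ^ t + 3 * 2 ^ n * 3 ^ t ≡ 3 * 2 ^ n * 4 ^ t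
  ∑ₛ-missingTop n t 2t≤n = begin-equality
    ∑ₛ n (missingTop t) * 4 ^ t + 3 * 2 ^ n * 3 ^ t
      ≡⟨ cong (_+ 3 * 2 ^ n * 3 ^ t) (∑ₛ-missingWindow n 0 t 2t≤n) ⟩
    2 ^ n * (3 * 1 * G) + 3 * 2 ^ n * 3 ^ t
      ≡⟨ solve 3 (λ P G x → P :* (con 3 :* con 1 :* G) :+ con 3 :* P :* x := con 3 :* P :* (G :+ x)) refl (2 ^ n) G (3 ^ t) ⟩
    3 * 2 ^ n * (G + 3 ^ t)
      ≡⟨ cong (3 * 2 ^ n *_) (geometric t) ⟩
    3 * 2 ^ n * 4 ^ t
      ∎
    where
    open ≤-Reasoning
    G = ∑ t (λ i → 3 ^ i * 4 ^ (t ∸ suc i))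

  ∑ₛ-missingWindow≤ : ∀ n J m → (J + m) + (J + m) ≤ n → ∑ₛ n (λ S → missingWindow S J m) * 4 ^ J ≤ 3 ^ suc J * 2 ^ n
  ∑ₛ-missingWindow≤ n J m 2[J+m]≤n = *-cancelʳ-≤ _ _ (4 ^ m) {{m^n≢0 4 m}} (begin
    ∑ₛ n (λ S → missingWindow S J m) * 4 ^ J * 4 ^ m
      ≡⟨ trans (*-assoc τ (4 ^ J) (4 ^ m)) (cong (τ *_) (sym (^-distribˡ-+-* 4 J m))) ⟩
    ∑ₛ n (λ S → missingWindow S J m) * 4 ^ (J + m)
      ≡⟨ ∑ₛ-missingWindow n J m 2[J+m]≤n ⟩
    2 ^ n * (3 ^ suc J * ∑ m (λ i → 3 ^ i * 4 ^ (m ∸ suc i)))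
      ≤⟨ *-monoʳ-≤ (2 ^ n) (*-monoʳ-≤ (3 ^ suc J) (≤-trans (m≤m+n _ (3 ^ m)) (≤-reflexive (geometric m)))) ⟩
    2 ^ n * (3 ^ suc J * 4 ^ m)
      ≡⟨ solve 3 (λ x y z → x :* (y :* z) := y :* x :* z) refl (2 ^ n) (3 ^ suc J) (4 ^ m) ⟩
    3 ^ suc J * 2 ^ n * 4 ^ m
      ∎)
    where
    open ≤-Reasoning
    τ = ∑ₛ n (λ S → missingWindow S J m)

  -- Near≤ Q a A b B states a/A ≤ b/B + 1/Q with the denominators cleared; Near< is strict.
  Near≤ : ℕ → ℕ → ℕ → ℕ → ℕ → Set
  Near≤ Q a A b B = Q * a * B ≤ Q * b * A + A * B

  Near< : ℕ → ℕ → ℕ → ℕ → ℕ → Set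
  Near< Q a A b B = Q * a * B < Q * b * A + A * B

  Near≤-trans : ∀ Q x A z F y B → 1 ≤ F → 1 ≤ A * B → Near≤ (4 * Q) x A z F → Near≤ (4 * Q) z F y B → Near< Q x A y B
  Near≤-trans Q x A z F y B 1≤F 1≤AB x≲z z≲y = *-cancelˡ-< 4 _ _ (begin-strict
    4 * (Q * x * B)
      ≤⟨ *-cancelʳ-≤ _ _ F {{>-nonZero 1≤F}} scaled ⟩
    4 * Q * y * A + 2 * (A * B)
      <⟨ +-monoʳ-< (4 * Q * y * A) (*-monoˡ-< (A * B) {{>-nonZero 1≤AB}} {2} {4} (s<s (s<s z<s))) ⟩
    4 * Q * y * A + 4 * (A * B)
      ≡⟨ solve 4 (λ Q y A B → con 4 :* Q :* y :* A :+ con 4 :* (A :* B) := con 4 :* (Q :* y :* A :+ A :* B)) refl Q y A B ⟩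
    4 * (Q * y * A + A * B)
      ∎)
    where
    open ≤-Reasoning
    scaled : 4 * (Q * x * B) * F ≤ (4 * Q * y * A + 2 * (A * B)) * F
    scaled = begin
      4 * (Q * x * B) * F
        ≡⟨ solve 4 (λ Q x B F → con 4 :* (Q :* x :* B) :* F := (con 4 :* Q :* x :* F) :* B) refl Q x B F ⟩
      (4 * Q * x * F) * B
        ≤⟨ *-monoˡ-≤ B x≲z ⟩
      (4 * Q * z * A + A * F) * B
        ≡⟨ solve 5 (λ Q z A F B → (con 4 :* Q :* z :* A :+ A :* F) :* B := (con 4 :* Q :* z :* B) :* A :+ A :* B :* F) refl Q z A F B ⟩
      (4 * Q * z * B) * A + A * B * F
        ≤⟨ +-monoˡ-≤ (A * B * F) (*-monoˡ-≤ A z≲y) ⟩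
      (4 * Q * y * F + F * B) * A + A * B * F
        ≡⟨ solve 5 (λ Q y F B A → (con 4 :* Q :* y :* F :+ F :* B) :* A :+ A :* B :* F := (con 4 :* Q :* y :* A :+ con 2 :* (A :* B)) :* F) refl Q y F B A ⟩
      (4 * Q * y * A + 2 * (A * B)) * F
        ∎

  scaled-error-bound : ∀ C x y E P F → x ≤ y + E → C * E ≤ P → C * x * F ≤ C * y * F + P * F
  scaled-error-bound C x y E P F x≤y+E CE≤P = begin
    C * x * F
      ≤⟨ *-monoˡ-≤ F (*-monoʳ-≤ C x≤y+E) ⟩
    C * (y + E) * F
      ≡⟨ solve 4 (λ C y E F → C :* (y :+ E) :* F := C :* y :* F :+ (C :* E) :* F) refl C y E F ⟩
    C * y * F + C * E * F
      ≤⟨ +-monoʳ-≤ (C * y * F) (*-monoˡ-≤ F CE≤P) ⟩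
    C * y * F + P * F
      ∎
    where open ≤-Reasoning

  -- With P = 2^n: F/P lies within E₁/P + E₂/P ≤ 1/(2Q) of 2Z/P, and 3 - 1/(8Q) ≤ Z/P ≤ 3.
  mean-near : ∀ Q F Z P E₁ E₂ → 1 ≤ P → F ≤ Z + Z + E₁ → Z + Z ≤ F + E₁ + E₂ →
    4 * Q * E₁ ≤ P → 4 * Q * E₂ ≤ P → Z ≤ 3 * P → 24 * Q * P ≤ 8 * Q * Z + P →
    Near< Q F P 6 1 × Near< Q 6 1 F P
  mean-near Q F Z P E₁ E₂ 1≤P F≲2Z 2Z≲F small₁ small₂ Z≤3P 3P≲Z = above , below
    where
    open ≤-Reasoning
    0<3P : 0 < 3 * P
    0<3P = ≤-trans 1≤P (m≤m+n P _)
    above : Q * F * 1 < Q * 6 * P + P * 1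
    above = *-cancelˡ-< 4 _ _ (begin-strict
      4 * (Q * F * 1)
        ≡⟨ solve 2 (λ Q F → con 4 :* (Q :* F :* con 1) := con 4 :* Q :* F) refl Q F ⟩
      4 * Q * F
        ≤⟨ *-monoʳ-≤ (4 * Q) F≲2Z ⟩
      4 * Q * (Z + Z + E₁)
        ≡⟨ solve 3 (λ Q Z E → con 4 :* Q :* (Z :+ Z :+ E) := con 8 :* Q :* Z :+ con 4 :* Q :* E) refl Q Z E₁ ⟩
      8 * Q * Z + 4 * Q * E₁
        ≤⟨ +-mono-≤ (*-monoʳ-≤ (8 * Q) Z≤3P) small₁ ⟩
      8 * Q * (3 * P) + P
        <⟨ m<m+n _ 0<3P ⟩
      8 * Q * (3 * P) + P + 3 * P
        ≡⟨ solve 2 (λ Q P → con 8 :* Q :* (con 3 :* P) :+ P :+ con 3 :* P := con 4 :* (Q :* con 6 :* P :+ P :* con 1)) refl Q P ⟩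
      4 * (Q * 6 * P + P * 1)
        ∎)
    below : Q * 6 * P < Q * F * 1 + 1 * P
    below = *-cancelˡ-< 4 _ _ (begin-strict
      4 * (Q * 6 * P)
        ≡⟨ solve 2 (λ Q P → con 4 :* (Q :* con 6 :* P) := con 24 :* Q :* P) refl Q P ⟩
      24 * Q * P
        ≤⟨ 3P≲Z ⟩
      8 * Q * Z + P
        ≡⟨ cong (_+ P) (solve 2 (λ Q Z → con 8 :* Q :* Z := con 4 :* Q :* (Z :+ Z)) refl Q Z) ⟩
      4 * Q * (Z + Z) + P
        ≤⟨ +-monoˡ-≤ P (*-monoʳ-≤ (4 * Q) 2Z≲F) ⟩
      4 * Q * (F + E₁ + E₂) + P
        ≡⟨ cong (_+ P) (trans (*-distribˡ-+ (4 * Q) (F + E₁) E₂) (cong (_+ 4 * Q * E₂) (*-distribˡ-+ (4 * Q) F E₁))) ⟩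
      4 * Q * F + 4 * Q * E₁ + 4 * Q * E₂ + P
        ≤⟨ +-monoˡ-≤ P (+-mono-≤ (+-monoʳ-≤ (4 * Q * F) small₁) small₂) ⟩
      4 * Q * F + P + P + P
        <⟨ m<m+n _ 1≤P ⟩
      4 * Q * F + P + P + P + P
        ≡⟨ solve 3 (λ Q F P → con 4 :* Q :* F :+ P :+ P :+ P :+ P := con 4 :* (Q :* F :* con 1 :+ con 1 :* P)) refl Q F P ⟩
      4 * (Q * F * 1 + 1 * P)
        ∎)

  -- Convergence

  missingCount≈topCount : ∀ n t k → suc t < n →
    missingCount n k ≤ topCount n t k + lowGapCount n t × topCount n t k ≤ missingCount n k + lowGapCount n t
  missingCount≈topCount n t k suc-t<n = subst (missingCount n k ≤_) (cong (topCount n t k +_) (*-identityˡ B)) up ,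
                                        subst (topCount n t k ≤_) (cong (missingCount n k +_) (*-identityˡ B)) down
    where
    B = lowGapCount n t
    φ : ℕ → ℕ
    φ x = 𝟙 ⌊ x ≟ k ⌋
    top2 : SubsetOf n → ℕ
    top2 S = missingTop t S + missingTop t S
    unless : ∀ S → missesLow t S ≡ false → missing S ≡ top2 S
    unless S = missing≡missingTop+missingTop t S suc-t<n
    up : missingCount n k ≤ topCount n t k + 1 * B
    up = ∑ₛ-≤-unless n φ 1 (λ x → 𝟙≤1 ⌊ x ≟ k ⌋) missing top2 (missesLow t) unless
    down : topCount n t k ≤ missingCount n k + 1 * B
    down = ∑ₛ-≤-unless n φ 1 (λ x → 𝟙≤1 ⌊ x ≟ k ⌋) top2 missing (missesLow t) (λ S e → sym (unless S e))

  topCount-rescale : ∀ n t k → t + t ≤ n → topCount n t k * 4 ^ t ≡ topCount (t + t) t k * 2 ^ n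
  topCount-rescale n t k t+t≤n = begin
    topCount n t k * 4 ^ t
      ≡⟨ cong (λ m → topCount m t k * 4 ^ t) n≡ ⟩
    topCount (t + (r + t)) t k * 4 ^ t
      ≡⟨ cong (_* 4 ^ t) (topCount-insert t r k) ⟩
    2 ^ r * z * 4 ^ t
      ≡⟨ solve 3 (λ R z F → R :* z :* F := z :* (R :* F)) refl (2 ^ r) z (4 ^ t) ⟩
    z * (2 ^ r * 4 ^ t)
      ≡⟨ cong (z *_) (sym 2^n≡) ⟩
    z * 2 ^ n
      ∎
    where
    open ≡-Reasoning
    r = n ∸ (t + t)
    z = topCount (t + t) t k
    n≡ : n ≡ t + (r + t)
    n≡ = trans (sym (m+[n∸m]≡n t+t≤n)) (solve 2 (λ t r → t :+ t :+ r := t :+ (r :+ t)) refl t r)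
    2^n≡ : 2 ^ n ≡ 2 ^ r * 4 ^ t
    2^n≡ = begin
      2 ^ n               ≡⟨ cong (2 ^_) (trans n≡ (solve 2 (λ t r → t :+ (r :+ t) := r :+ (t :+ t)) refl t r)) ⟩
      2 ^ (r + (t + t))   ≡⟨ ^-distribˡ-+-* 2 r (t + t) ⟩
      2 ^ r * 2 ^ (t + t) ≡⟨ cong (2 ^ r *_) (2^[m+m]≡4^m t) ⟩
      2 ^ r * 4 ^ t       ∎

  missingCount-near-topCount : ∀ Q t k → 8 * (4 * Q) * 3 ^ (t + 1) ≤ 4 ^ (t + 1) →
    ∃[ N ] (∀ n → N ≤ n → Near≤ (4 * Q) (missingCount n k) (2 ^ n) (topCount (t + t) t k) (4 ^ t)
                        × Near≤ (4 * Q) (topCount (t + t) t k) (4 ^ t) (missingCount n k) (2 ^ n))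
  missingCount-near-topCount Q t k long-top = N₀ + (t + t + 2) , near
    where
    rarity : ∃[ N ] (∀ n → N ≤ n → 4 * Q * lowGapCount n t ≤ 2 ^ n)
    rarity = lowGapCount-eventually-small (4 * Q) t long-top
    N₀ = proj₁ rarity
    near : ∀ n → N₀ + (t + t + 2) ≤ n → Near≤ (4 * Q) (missingCount n k) (2 ^ n) (topCount (t + t) t k) (4 ^ t)
                                      × Near≤ (4 * Q) (topCount (t + t) t k) (4 ^ t) (missingCount n k) (2 ^ n)
    near n N≤n = subst (λ x → 4 * Q * c * 4 ^ t ≤ x + 2 ^ n * 4 ^ t) rescale
                   (scaled-error-bound (4 * Q) c z′ B (2 ^ n) (4 ^ t) (proj₁ c≈z′) rare) ,
                 (begin
                   4 * Q * z * 2 ^ n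
                     ≡⟨ sym rescale ⟩
                   4 * Q * z′ * 4 ^ t
                     ≤⟨ scaled-error-bound (4 * Q) z′ c B (2 ^ n) (4 ^ t) (proj₂ c≈z′) rare ⟩
                   4 * Q * c * 4 ^ t + 2 ^ n * 4 ^ t
                     ≡⟨ cong (4 * Q * c * 4 ^ t +_) (*-comm (2 ^ n) (4 ^ t)) ⟩
                   4 * Q * c * 4 ^ t + 4 ^ t * 2 ^ n
                     ∎)
      where
      open ≤-Reasoning
      t+t+2≤n : t + t + 2 ≤ n
      t+t+2≤n = ≤-trans (m≤n+m (t + t + 2) N₀) N≤n
      c = missingCount n k
      z′ = topCount n t k
      z = topCount (t + t) t k
      B = lowGapCount n t
      rare : 4 * Q * B ≤ 2 ^ n
      rare = proj₂ rarity n (≤-trans (m≤m+n N₀ _) N≤n)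
      c≈z′ : c ≤ z′ + B × z′ ≤ c + B
      c≈z′ = missingCount≈topCount n t k (≤-trans (s≤s (s≤s (m≤n+m t t))) (≤-trans (≤-reflexive (+-comm 2 (t + t))) t+t+2≤n))
      rescale : 4 * Q * z′ * 4 ^ t ≡ 4 * Q * z * 2 ^ n
      rescale = trans (*-assoc (4 * Q) z′ (4 ^ t))
        (trans (cong (4 * Q *_) (topCount-rescale n t k (m+n≤o⇒m≤o (t + t) t+t+2≤n))) (sym (*-assoc (4 * Q) z (2 ^ n))))

  missingCount-Cauchy : ∀ Q k → ∃[ N ] (∀ m n → N ≤ m → N ≤ n → Near< Q (missingCount m k) (2 ^ m) (missingCount n k) (2 ^ n))
  missingCount-Cauchy Q k = proj₁ approx , λ m n N≤m N≤n →
    Near≤-trans Q (missingCount m k) (2 ^ m) (topCount (t + t) t k) (4 ^ t) (missingCount n k) (2 ^ n)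
      (m^n>0 4 t) (*-mono-≤ (m^n>0 2 m) (m^n>0 2 n)) (proj₁ (proj₂ approx m N≤m)) (proj₂ (proj₂ approx n N≤n))
    where
    t = 18 * (8 * (4 * Q))
    approx : ∃[ N ] (∀ n → N ≤ n → Near≤ (4 * Q) (missingCount n k) (2 ^ n) (topCount (t + t) t k) (4 ^ t)
                                 × Near≤ (4 * Q) (topCount (t + t) t k) (4 ^ t) (missingCount n k) (2 ^ n))
    approx = missingCount-near-topCount Q t k (C*3^n≤4^n (8 * (4 * Q)) (t + 1) (≤-reflexive (+-comm 1 t)))

  missingTop-mean : ∀ Q n t → t + t ≤ n → 24 * Q * 3 ^ t ≤ 4 ^ t →
    ∑ₛ n (missingTop t) ≤ 3 * 2 ^ n × 24 * Q * 2 ^ n ≤ 8 * Q * ∑ₛ n (missingTop t) + 2 ^ n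
  missingTop-mean Q n t 2t≤n long-top = at-most , at-least
    where
    open ≤-Reasoning
    Z = ∑ₛ n (missingTop t)
    P = 2 ^ n
    at-most : Z ≤ 3 * P
    at-most = *-cancelʳ-≤ Z (3 * P) (4 ^ t) {{m^n≢0 4 t}}
      (≤-trans (m≤m+n (Z * 4 ^ t) _) (≤-reflexive (∑ₛ-missingTop n t 2t≤n)))
    at-least : 24 * Q * P ≤ 8 * Q * Z + P
    at-least = *-cancelʳ-≤ _ _ (4 ^ t) {{m^n≢0 4 t}} (begin
      24 * Q * P * 4 ^ t
        ≡⟨ solve 3 (λ Q P F → con 24 :* Q :* P :* F := con 8 :* Q :* (con 3 :* P :* F)) refl Q P (4 ^ t) ⟩
      8 * Q * (3 * P * 4 ^ t)
        ≡⟨ cong (8 * Q *_) (sym (∑ₛ-missingTop n t 2t≤n)) ⟩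
      8 * Q * (Z * 4 ^ t + 3 * P * 3 ^ t)
        ≡⟨ solve 5 (λ Q Z F P x → con 8 :* Q :* (Z :* F :+ con 3 :* P :* x) := con 8 :* Q :* Z :* F :+ P :* (con 24 :* Q :* x)) refl Q Z (4 ^ t) P (3 ^ t) ⟩
      8 * Q * Z * 4 ^ t + P * (24 * Q * 3 ^ t)
        ≤⟨ +-monoʳ-≤ (8 * Q * Z * 4 ^ t) (*-monoʳ-≤ P long-top) ⟩
      8 * Q * Z * 4 ^ t + P * 4 ^ t
        ≡⟨ sym (*-distribʳ-+ (4 ^ t) (8 * Q * Z) P) ⟩
      (8 * Q * Z + P) * 4 ^ t
        ∎)

  missingWindow-small : ∀ Q n J u → (J + u) + (J + u) ≤ n → 4 * Q * (J + J + 2) * 3 ^ suc J ≤ 4 ^ J →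
    4 * Q * ((J + J + 2) * ∑ₛ n (λ S → missingWindow S J u)) ≤ 2 ^ n
  missingWindow-small Q n J u 2[J+u]≤n long-window = *-cancelʳ-≤ _ _ (4 ^ J) {{m^n≢0 4 J}} (begin
    4 * Q * ((J + J + 2) * τ) * 4 ^ J
      ≡⟨ solve 4 (λ Q W τ F → con 4 :* Q :* (W :* τ) :* F := con 4 :* Q :* W :* (τ :* F)) refl Q (J + J + 2) τ (4 ^ J) ⟩
    4 * Q * (J + J + 2) * (τ * 4 ^ J)
      ≤⟨ *-monoʳ-≤ (4 * Q * (J + J + 2)) (∑ₛ-missingWindow≤ n J u 2[J+u]≤n) ⟩
    4 * Q * (J + J + 2) * (3 ^ suc J * 2 ^ n)
      ≡⟨ sym (*-assoc (4 * Q * (J + J + 2)) _ _) ⟩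
    4 * Q * (J + J + 2) * 3 ^ suc J * 2 ^ n
      ≤⟨ *-monoˡ-≤ (2 ^ n) long-window ⟩
    4 ^ J * 2 ^ n
      ≡⟨ *-comm (4 ^ J) (2 ^ n) ⟩
    2 ^ n * 4 ^ J
      ∎)
    where
    open ≤-Reasoning
    τ = ∑ₛ n (λ S → missingWindow S J u)

  truncatedSum-sandwich : ∀ n J u K → J + J < K → suc (J + u) < n →
    let F = ∑ₛ n (truncate K ∘ missing)
        Z = ∑ₛ n (missingTop (J + u))
        B = lowGapCount n (J + u)
        τ = ∑ₛ n (λ S → missingWindow S J u)
    in F ≤ Z + Z + K * B × Z + Z ≤ F + K * B + (J + J + 2) * τ
  truncatedSum-sandwich n J u K 2J<K suc-t<n = F≤ , 2Z≤
    where
    open ≤-Reasoning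
    t = J + u
    top2 : SubsetOf n → ℕ
    top2 S = missingTop t S + missingTop t S
    F = ∑ₛ n (truncate K ∘ missing)
    G = ∑ₛ n (truncate K ∘ top2)
    Z = ∑ₛ n (missingTop t)
    B = lowGapCount n t
    τ = ∑ₛ n (λ S → missingWindow S J u)
    unless : ∀ S → missesLow t S ≡ false → missing S ≡ top2 S
    unless S = missing≡missingTop+missingTop t S suc-t<n
    G≤2Z : G ≤ Z + Z
    G≤2Z = ≤-trans (∑ₗ-mono (allSubsets n) (truncate≤id K ∘ top2)) (≤-reflexive (∑ₗ-+ (allSubsets n) (missingTop t) (missingTop t)))
    F≤ : F ≤ Z + Z + K * B
    F≤ = begin
      F
        ≤⟨ ∑ₛ-≤-unless n (truncate K) K (truncate≤K K) missing top2 (missesLow t) unless ⟩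
      G + K * B
        ≤⟨ +-monoˡ-≤ (K * B) G≤2Z ⟩
      Z + Z + K * B
        ∎
    2Z≤ : Z + Z ≤ F + K * B + (J + J + 2) * τ
    2Z≤ = begin
      Z + Z                     ≡⟨ sym (∑ₗ-+ (allSubsets n) (missingTop t) (missingTop t)) ⟩
      ∑ₛ n top2                 ≤⟨ ∑ₗ-mono (allSubsets n) pointwise ⟩
      ∑ₛ n (λ S → truncate K (top2 S) + (J + J + 2) * missingWindow S J u)
                                ≡⟨ ∑ₗ-+ (allSubsets n) (truncate K ∘ top2) _ ⟩
      G + ∑ₛ n (λ S → (J + J + 2) * missingWindow S J u)
                                ≡⟨ cong (G +_) (∑ₗ-*ˡ (allSubsets n) (J + J + 2) _) ⟩
      G + (J + J + 2) * τ       ≤⟨ +-monoˡ-≤ _ G≤F+KB ⟩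
      F + K * B + (J + J + 2) * τ ∎
      where
      G≤F+KB : G ≤ F + K * B
      G≤F+KB = ∑ₛ-≤-unless n (truncate K) K (truncate≤K K) top2 missing (missesLow t) (λ S e → sym (unless S e))
      pointwise : ∀ S → top2 S ≤ truncate K (top2 S) + (J + J + 2) * missingWindow S J u
      pointwise S = subst (λ x → x + x ≤ truncate K (x + x) + (J + J + 2) * missingWindow S J u) (sym (∑-++ J u _))
        (double-truncate (missingTop J S) (missingWindow S J u) J K
          (≤-trans (∑-mono J (λ i _ → 𝟙≤1 _)) (≤-reflexive (trans (∑-const J 1) (*-identityʳ J)))) 2J<K)

  truncatedMean-near : ∀ Q J u K → J + J < K → 4 * Q * (J + J + 2) * 3 ^ suc J ≤ 4 ^ J →
    24 * Q * K * 3 ^ (J + u) ≤ 4 ^ (J + u) →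
    ∃[ N ] (∀ n → N ≤ n → Near< Q (∑ₛ n (truncate K ∘ missing)) (2 ^ n) 6 1 × Near< Q 6 1 (∑ₛ n (truncate K ∘ missing)) (2 ^ n))
  truncatedMean-near Q J u K 2J<K long-window long-top = N₀ + (t + t + 2) , near
    where
    open ≤-Reasoning
    t = J + u
    1≤K : 1 ≤ K
    1≤K = ≤-trans (s≤s z≤n) 2J<K
    rarity : ∃[ N ] (∀ n → N ≤ n → 4 * Q * K * lowGapCount n t ≤ 2 ^ n)
    rarity = lowGapCount-eventually-small (4 * Q * K) t (begin
      8 * (4 * Q * K) * 3 ^ (t + 1)
        ≡⟨ cong (λ e → 8 * (4 * Q * K) * 3 ^ e) (+-comm t 1) ⟩
      8 * (4 * Q * K) * (3 * 3 ^ t)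
        ≡⟨ solve 3 (λ Q K x → con 8 :* (con 4 :* Q :* K) :* (con 3 :* x) := con 4 :* (con 24 :* Q :* K :* x)) refl Q K (3 ^ t) ⟩
      4 * (24 * Q * K * 3 ^ t)
        ≤⟨ *-monoʳ-≤ 4 long-top ⟩
      4 * 4 ^ t
        ≡⟨ cong (4 ^_) (+-comm 1 t) ⟩
      4 ^ (t + 1)
        ∎)
    N₀ = proj₁ rarity
    near : ∀ n → N₀ + (t + t + 2) ≤ n →
      Near< Q (∑ₛ n (truncate K ∘ missing)) (2 ^ n) 6 1 × Near< Q 6 1 (∑ₛ n (truncate K ∘ missing)) (2 ^ n)
    near n N≤n = mean-near Q F Z (2 ^ n) (K * B) ((J + J + 2) * τ) (m^n>0 2 n)
      (proj₁ sandwich) (proj₂ sandwich) rare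
      (missingWindow-small Q n J u t+t≤n long-window)
      (proj₁ mean) (proj₂ mean)
      where
      t+t+2≤n : t + t + 2 ≤ n
      t+t+2≤n = ≤-trans (m≤n+m (t + t + 2) N₀) N≤n
      t+t≤n : t + t ≤ n
      t+t≤n = m+n≤o⇒m≤o (t + t) t+t+2≤n
      F = ∑ₛ n (truncate K ∘ missing)
      Z = ∑ₛ n (missingTop t)
      B = lowGapCount n t
      τ = ∑ₛ n (λ S → missingWindow S J u)
      sandwich : F ≤ Z + Z + K * B × Z + Z ≤ F + K * B + (J + J + 2) * τ
      sandwich = truncatedSum-sandwich n J u K 2J<K
        (≤-trans (s≤s (s≤s (m≤n+m t t))) (≤-trans (≤-reflexive (+-comm 2 (t + t))) t+t+2≤n))
      rare : 4 * Q * (K * B) ≤ 2 ^ n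
      rare = subst (_≤ 2 ^ n) (*-assoc (4 * Q) K B) (proj₂ rarity n (≤-trans (m≤m+n N₀ _) N≤n))
      mean : Z ≤ 3 * 2 ^ n × 24 * Q * 2 ^ n ≤ 8 * Q * Z + 2 ^ n
      mean = missingTop-mean Q n t t+t≤n (≤-trans (*-monoˡ-≤ (3 ^ t) (m≤m*n (24 * Q) K {{>-nonZero 1≤K}})) long-top)

  truncatedMean-converges : ∀ Q → ∃[ K ] (∀ K′ → K ≤ K′ → ∃[ N ] (∀ n → N ≤ n →
    Near< Q (∑ₛ n (truncate K′ ∘ missing)) (2 ^ n) 6 1 × Near< Q 6 1 (∑ₛ n (truncate K′ ∘ missing)) (2 ^ n)))
  truncatedMean-converges Q = suc (J + J) , λ K K≤ →
    truncatedMean-near Q J (u K) K K≤ long-window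
      (C*3^n≤4^n (24 * Q * K) (J + u K) (≤-trans (n<1+n _) (m≤n+m (u K) J)))
    where
    open ≤-Reasoning
    J = suc (18 * (48 * Q))
    u : ℕ → ℕ
    u K = suc (18 * (24 * Q * K))
    long-window : 4 * Q * (J + J + 2) * 3 ^ suc J ≤ 4 ^ J
    long-window = begin
      4 * Q * (J + J + 2) * (3 * 3 ^ J)
        ≤⟨ *-monoˡ-≤ (3 * 3 ^ J) (*-monoʳ-≤ (4 * Q) (+-monoʳ-≤ (J + J) (*-monoʳ-≤ 2 (s≤s z≤n)))) ⟩
      4 * Q * (J + J + 2 * J) * (3 * 3 ^ J)
        ≡⟨ solve 3 (λ Q J x → con 4 :* Q :* (J :+ J :+ con 2 :* J) :* (con 3 :* x) := con 48 :* Q :* J :* x) refl Q J (3 ^ J) ⟩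
      48 * Q * J * 3 ^ J
        ≤⟨ C*n*3^n≤4^n (48 * Q) J (n≤1+n _) ⟩
      4 ^ J
        ∎

module RationalBounds where

  open import Data.Nat as ℕ using (ℕ; zero; suc)
  import Data.Nat.Properties as ℕ
  open import Data.Integer as ℤ using (ℤ; +≤+; +<+)
  import Data.Integer.Properties as ℤ
  open import Data.List using (map; applyUpTo; foldr)
  open import Data.Rational using (ℚ; mkℚ; _/_; _+_; _*_; _-_; -_; _≤_; _<_; 1ℚ; 0ℚ; ½; ∣_∣; *≤*; *<*)
  import Data.Rational.Properties as ℚ
  import Data.Rational.Unnormalised as ℚᵘ
  import Data.Rational.Unnormalised.Properties as ℚᵘ
  open import Data.Rational.Solver using (module +-*-Solver)
  open import Data.Nat.Coprimality using (1-coprimeTo; sym)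
  open import Data.Product using (∃-syntax; _,_)
  open import Data.Sum using (inj₁; inj₂)
  open import Function using (_∘_)
  open import Relation.Binary.PropositionalEquality hiding (sym)
  import Relation.Binary.PropositionalEquality as ≡
  open import Relation.Nullary.Decidable using (⌊_⌋)

  open Counting using (Near<; ∑; ∑-cong; ∑ₗ-*ˡ; ∑ₛ; ∑ₛ-∑; 𝟙; truncate; missingCount; countMissing≡missingCount)
  open +-*-Solver

  ι : ℕ → ℚ
  ι c = ℤ.+ c / 1

  ι≡mkℚ : ∀ c → ι c ≡ mkℚ (ℤ.+ c) 0 (sym (1-coprimeTo c))
  ι≡mkℚ c = ℚ.↥p/↧p≡p (mkℚ (ℤ.+ c) 0 (sym (1-coprimeTo c)))

  ι-+ : ∀ a b → ι (a ℕ.+ b) ≡ ι a + ι b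
  ι-+ a b rewrite ι≡mkℚ a | ι≡mkℚ b = ≡.sym (cong₂ (λ x y → (x ℤ.+ y) / 1) (ℤ.*-identityʳ (ℤ.+ a)) (ℤ.*-identityʳ (ℤ.+ b)))

  ι-* : ∀ a b → ι (a ℕ.* b) ≡ ι a * ι b
  ι-* a b rewrite ι≡mkℚ a | ι≡mkℚ b = cong (_/ 1) (ℤ.pos-* a b)

  ι-< : ∀ {a b} → a ℕ.< b → ι a < ι b
  ι-< {a} {b} a<b rewrite ι≡mkℚ a | ι≡mkℚ b =
    *<* (subst₂ ℤ._<_ (≡.sym (ℤ.*-identityʳ (ℤ.+ a))) (≡.sym (ℤ.*-identityʳ (ℤ.+ b))) (+<+ a<b))

  *ι-cancelʳ-< : ∀ c {p q} → p * ι c < q * ι c → p < q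
  *ι-cancelʳ-< c rewrite ι≡mkℚ c = ℚ.*-cancelʳ-<-nonNeg (mkℚ (ℤ.+ c) 0 (sym (1-coprimeTo c)))

  half^n*2^n≡1 : ∀ n → half^ n * ι (2 ℕ.^ n) ≡ 1ℚ
  half^n*2^n≡1 zero    = refl
  half^n*2^n≡1 (suc n) = begin
    ½ * half^ n * ι (2 ℕ.* 2 ℕ.^ n)
      ≡⟨ cong (½ * half^ n *_) (ι-* 2 (2 ℕ.^ n)) ⟩
    ½ * half^ n * (ι 2 * ι (2 ℕ.^ n))
      ≡⟨ solve 4 (λ a b c d → (a :* b) :* (c :* d) := (a :* c) :* (b :* d)) refl ½ (half^ n) (ι 2) (ι (2 ℕ.^ n)) ⟩
    ½ * ι 2 * (half^ n * ι (2 ℕ.^ n))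
      ≡⟨ cong (½ * ι 2 *_) (half^n*2^n≡1 n) ⟩
    1ℚ
      ∎
    where open ≡-Reasoning

  archimedean : ∀ ε → 0ℚ < ε → ∃[ Q ] (1ℚ ≤ ε * ι Q)
  archimedean ε@(mkℚ (ℤ.+ suc p) d _) _ = suc d , subst (λ x → 1ℚ ≤ ε * x) (≡.sym (ι≡mkℚ (suc d)))
    (ℚ.toℚᵘ-cancel-≤ (ℚᵘ.≤-respʳ-≃ (ℚᵘ.≃-sym (ℚ.toℚᵘ-homo-* ε (mkℚ (ℤ.+ suc d) 0 (sym (1-coprimeTo (suc d)))))) (ℚᵘ.*≤* cross)))
    where
    cross : ℤ.+ 1 ℤ.* ℤ.+ suc (d ℕ.* 1) ℤ.≤ (ℤ.+ suc p ℤ.* ℤ.+ suc d) ℤ.* ℤ.+ 1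
    cross = subst₂ ℤ._≤_ (≡.sym (ℤ.*-identityˡ _)) (≡.sym (ℤ.*-identityʳ _))
      (+≤+ (subst (ℕ._≤ suc p ℕ.* suc d) (cong suc (≡.sym (ℕ.*-identityʳ d))) (ℕ.m≤n*m (suc d) (suc p))))
  archimedean (mkℚ (ℤ.+ zero)   _ _) (*<* (+<+ ()))
  archimedean (mkℚ ℤ.-[1+ _ ] _ _) (*<* ())

  Near<⇒< : ∀ Q a A b B (hA hB : ℚ) → hA * ι A ≡ 1ℚ → hB * ι B ≡ 1ℚ →
    Near< Q a A b B → ι Q * (ι a * hA) < 1ℚ + ι Q * (ι b * hB)
  Near<⇒< Q a A b B hA hB hA*A≡1 hB*B≡1 near = *ι-cancelʳ-< (A ℕ.* B) (subst₂ _<_ (≡.sym lhs) (≡.sym rhs) (ι-< near))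
    where
    open ≡-Reasoning
    lhs : ι Q * (ι a * hA) * ι (A ℕ.* B) ≡ ι (Q ℕ.* a ℕ.* B)
    lhs = begin
      ι Q * (ι a * hA) * ι (A ℕ.* B)
        ≡⟨ cong (ι Q * (ι a * hA) *_) (ι-* A B) ⟩
      ι Q * (ι a * hA) * (ι A * ι B)
        ≡⟨ solve 5 (λ q x h y z → (q :* (x :* h)) :* (y :* z) := (q :* x :* z) :* (h :* y)) refl (ι Q) (ι a) hA (ι A) (ι B) ⟩
      ι Q * ι a * ι B * (hA * ι A)
        ≡⟨ cong (ι Q * ι a * ι B *_) hA*A≡1 ⟩
      ι Q * ι a * ι B * 1ℚ
        ≡⟨ ℚ.*-identityʳ (ι Q * ι a * ι B) ⟩
      ι Q * ι a * ι B
        ≡⟨ ≡.sym (trans (ι-* (Q ℕ.* a) B) (cong (_* ι B) (ι-* Q a))) ⟩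
      ι (Q ℕ.* a ℕ.* B)
        ∎
    rhs : (1ℚ + ι Q * (ι b * hB)) * ι (A ℕ.* B) ≡ ι (Q ℕ.* b ℕ.* A ℕ.+ A ℕ.* B)
    rhs = begin
      (1ℚ + ι Q * (ι b * hB)) * ι (A ℕ.* B)
        ≡⟨ cong ((1ℚ + ι Q * (ι b * hB)) *_) (ι-* A B) ⟩
      (1ℚ + ι Q * (ι b * hB)) * (ι A * ι B)
        ≡⟨ solve 5 (λ q x g y z → (con 1ℚ :+ q :* (x :* g)) :* (y :* z) := (q :* x :* y) :* (g :* z) :+ y :* z)
                   refl (ι Q) (ι b) hB (ι A) (ι B) ⟩
      ι Q * ι b * ι A * (hB * ι B) + ι A * ι B
        ≡⟨ cong (λ k → ι Q * ι b * ι A * k + ι A * ι B) hB*B≡1 ⟩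
      ι Q * ι b * ι A * 1ℚ + ι A * ι B
        ≡⟨ cong (_+ ι A * ι B) (ℚ.*-identityʳ (ι Q * ι b * ι A)) ⟩
      ι Q * ι b * ι A + ι A * ι B
        ≡⟨ ≡.sym (trans (ι-+ (Q ℕ.* b ℕ.* A) (A ℕ.* B))
                         (cong₂ _+_ (trans (ι-* (Q ℕ.* b) A) (cong (_* ι A) (ι-* Q b))) (ι-* A B))) ⟩
      ι (Q ℕ.* b ℕ.* A ℕ.+ A ℕ.* B)
        ∎

  p<1+q⇒p-q<1 : ∀ {p q} → p < 1ℚ + q → p - q < 1ℚ
  p<1+q⇒p-q<1 {p} {q} p<1+q = subst (p - q <_) (solve 1 (λ q → (con 1ℚ :+ q) :- q := con 1ℚ) refl q) (ℚ.+-monoˡ-< (- q) p<1+q)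

  ∣-∣<-from-scaled : ∀ (x y ε : ℚ) Q → 1ℚ ≤ ε * ι Q → ι Q * x < 1ℚ + ι Q * y → ι Q * y < 1ℚ + ι Q * x → ∣ x - y ∣ < ε
  ∣-∣<-from-scaled x y ε Q 1≤εQ x<y+ y<x+ with ℚ.∣p∣≡p∨∣p∣≡-p (x - y)
  ... | inj₁ ∣x-y∣≡x-y = subst (_< ε) (≡.sym ∣x-y∣≡x-y) (*ι-cancelʳ-< Q (ℚ.<-≤-trans
    (subst (_< 1ℚ) (solve 3 (λ q x y → q :* x :- q :* y := (x :- y) :* q) refl (ι Q) x y) (p<1+q⇒p-q<1 x<y+)) 1≤εQ))
  ... | inj₂ ∣x-y∣≡y-x = subst (_< ε) (≡.sym ∣x-y∣≡y-x) (*ι-cancelʳ-< Q (ℚ.<-≤-trans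
    (subst (_< 1ℚ) (solve 3 (λ q x y → q :* y :- q :* x := (:- (x :- y)) :* q) refl (ι Q) x y) (p<1+q⇒p-q<1 y<x+)) 1≤εQ))

  ∣-∣<-from-Near : ∀ Q a A b B (hA hB ε : ℚ) → 1ℚ ≤ ε * ι Q → hA * ι A ≡ 1ℚ → hB * ι B ≡ 1ℚ →
    Near< Q a A b B → Near< Q b B a A → ∣ ι a * hA - ι b * hB ∣ < ε
  ∣-∣<-from-Near Q a A b B hA hB ε 1≤εQ hA*A≡1 hB*B≡1 a≲b b≲a =
    ∣-∣<-from-scaled (ι a * hA) (ι b * hB) ε Q 1≤εQ
      (Near<⇒< Q a A b B hA hB hA*A≡1 hB*B≡1 a≲b) (Near<⇒< Q b B a A hB hA hB*B≡1 hA*A≡1 b≲a)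

  prob≡ : ∀ n k → prob n k ≡ ι (missingCount n k) * half^ n
  prob≡ n k = cong (λ c → ι c * half^ n) (countMissing≡missingCount n k)

  foldr-ι : ∀ (c : ℕ → ℕ) h (g : ℕ → ℕ) K →
    foldr _+_ 0ℚ (map (λ i → ι i * (ι (c i) * h)) (applyUpTo g K)) ≡ ι (∑ K (λ i → g i ℕ.* c (g i))) * h
  foldr-ι c h g zero    = ≡.sym (ℚ.*-zeroˡ h)
  foldr-ι c h g (suc K) = begin
    ι (g 0) * (ι (c (g 0)) * h) + foldr _+_ 0ℚ (map (λ i → ι i * (ι (c i) * h)) (applyUpTo (g ∘ suc) K))
      ≡⟨ cong₂ _+_ (≡.sym (ℚ.*-assoc (ι (g 0)) (ι (c (g 0))) h)) (foldr-ι c h (g ∘ suc) K) ⟩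
    ι (g 0) * ι (c (g 0)) * h + ι rest * h
      ≡⟨ ≡.sym (ℚ.*-distribʳ-+ h (ι (g 0) * ι (c (g 0))) (ι rest)) ⟩
    (ι (g 0) * ι (c (g 0)) + ι rest) * h
      ≡⟨ cong (_* h) (≡.sym (trans (ι-+ (g 0 ℕ.* c (g 0)) rest) (cong (_+ ι rest) (ι-* (g 0) (c (g 0)))))) ⟩
    ι (g 0 ℕ.* c (g 0) ℕ.+ rest) * h
      ∎
    where
    open ≡-Reasoning
    rest = ∑ K (λ i → g (suc i) ℕ.* c (g (suc i)))

  partialMean≡ : ∀ n K → partialMean n K ≡ ι (∑ₛ n (truncate K ∘ missing)) * half^ n
  partialMean≡ n K = trans (foldr-ι (countMissing n) (half^ n) (λ i → i) K) (cong (λ x → ι x * half^ n) (begin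
    ∑ K (λ i → i ℕ.* countMissing n i)
      ≡⟨ ∑-cong K (λ i _ → cong (i ℕ.*_) (countMissing≡missingCount n i)) ⟩
    ∑ K (λ i → i ℕ.* missingCount n i)
      ≡⟨ ∑-cong K (λ i _ → ≡.sym (∑ₗ-*ˡ (allSubsets n) i _)) ⟩
    ∑ K (λ i → ∑ₛ n (λ S → i ℕ.* 𝟙 ⌊ missing S ℕ.≟ i ⌋))
      ≡⟨ ≡.sym (∑ₛ-∑ n K (λ S i → i ℕ.* 𝟙 ⌊ missing S ℕ.≟ i ⌋)) ⟩
    ∑ₛ n (truncate K ∘ missing)
      ∎))
    where open ≡-Reasoning

open import Data.Nat using (ℕ; _≥_)
import Data.Nat as ℕ
open import Data.Integer using (+_)
open import Data.Rational using (ℚ; _≤_; _<_; _*_; _-_; ∣_∣; 0ℚ; 1ℚ; _/_)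
import Data.Rational.Properties as ℚ
open import Data.Product using (_×_; ∃-syntax; _,_; proj₁; proj₂)
open import Function using (_∘_)
open import Relation.Binary.PropositionalEquality using (refl; sym; subst₂)
open Counting using (Near<; missingCount; missingCount-Cauchy; ∑ₛ; truncate; truncatedMean-converges)
open RationalBounds

lemma3p21 :
    -- (i) for every k, the sequence n ↦ P(2n-1-|S-S| = k) is Cauchy (ℓ(k) exists)
    ((k : ℕ) → (ε : ℚ) → 0ℚ < ε →
      ∃[ N ] ((m n : ℕ) → m ≥ N → n ≥ N → ∣ prob m k - prob n k ∣ < ε))
    ×
    -- (ii) Σ_{i≥0} i ℓ(i) = 6: for every ε > 0 there is K such that for all K' ≥ K,
    --      eventually in n, |Σ_{i<K'} i P_n(i) - 6| < ε
    ((ε : ℚ) → 0ℚ < ε →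
      ∃[ K ] ((K' : ℕ) → K' ≥ K →
        ∃[ N ] ((n : ℕ) → n ≥ N → ∣ partialMean n K' - (+ 6 / 1) ∣ < ε)))
lemma3p21 = prob-Cauchy , partialMean→6
  where
  prob-Cauchy : (k : ℕ) (ε : ℚ) → 0ℚ < ε → ∃[ N ] ((m n : ℕ) → m ≥ N → n ≥ N → ∣ prob m k - prob n k ∣ < ε)
  prob-Cauchy k ε 0<ε = proj₁ cauchy , λ m n N≤m N≤n →
    subst₂ (λ x y → ∣ x - y ∣ < ε) (sym (prob≡ m k)) (sym (prob≡ n k))
      (∣-∣<-from-Near Q (missingCount m k) (2 ℕ.^ m) (missingCount n k) (2 ℕ.^ n) (half^ m) (half^ n) ε 1≤εQ
        (half^n*2^n≡1 m) (half^n*2^n≡1 n) (proj₂ cauchy m n N≤m N≤n) (proj₂ cauchy n m N≤n N≤m))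
    where
    Q = proj₁ (archimedean ε 0<ε)
    1≤εQ : 1ℚ ≤ ε * ι Q
    1≤εQ = proj₂ (archimedean ε 0<ε)
    cauchy : ∃[ N ] (∀ m n → N ℕ.≤ m → N ℕ.≤ n → Near< Q (missingCount m k) (2 ℕ.^ m) (missingCount n k) (2 ℕ.^ n))
    cauchy = missingCount-Cauchy Q k

  partialMean→6 : (ε : ℚ) → 0ℚ < ε →
    ∃[ K ] ((K′ : ℕ) → K′ ≥ K → ∃[ N ] ((n : ℕ) → n ≥ N → ∣ partialMean n K′ - (+ 6 / 1) ∣ < ε))
  partialMean→6 ε 0<ε = proj₁ converges , λ K′ K≤K′ → proj₁ (proj₂ converges K′ K≤K′) , λ n N≤n →
    subst₂ (λ x y → ∣ x - y ∣ < ε) (sym (partialMean≡ n K′)) (ℚ.*-identityʳ (ι 6))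
      (∣-∣<-from-Near Q (∑ₛ n (truncate K′ ∘ missing)) (2 ℕ.^ n) 6 1 (half^ n) 1ℚ ε 1≤εQ
        (half^n*2^n≡1 n) refl (proj₁ (proj₂ (proj₂ converges K′ K≤K′) n N≤n))
        (proj₂ (proj₂ (proj₂ converges K′ K≤K′) n N≤n)))
    where
    Q = proj₁ (archimedean ε 0<ε)
    1≤εQ : 1ℚ ≤ ε * ι Q
    1≤εQ = proj₂ (archimedean ε 0<ε)
    converges : ∃[ K ] (∀ K′ → K ℕ.≤ K′ → ∃[ N ] (∀ n → N ℕ.≤ n →
      Near< Q (∑ₛ n (truncate K′ ∘ missing)) (2 ℕ.^ n) 6 1 × Near< Q 6 1 (∑ₛ n (truncate K′ ∘ missing)) (2 ℕ.^ n)))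
    converges = truncatedMean-converges Q
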